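{- Let $A\geq a\geq 1$ be integers. The generating function $\sum_\pi q^{|\pi|}$ over the overpartitions $\pi$ such that $\pi$ has at least one non-overlined part whose size is $\equiv a\pmod A$ and less than $mes_{1,A,a}(\pi)$ is \[\frac{(-q;q)_{\infty}}{(q;q)_{\infty}}\sum_{k=1}^{\infty}q^{A\binom{k}{2}+ka} \frac{(q^a;q^A)_{k-1}}{(-q^a;q^A)_{k-1}}.\]
   Context: An overpartition is a partition (finite non-increasing sequence of positive integers) in which the first occurrence of each part value may be overlined; $|\pi|$ is the sum of parts. A part is of size $t$ if it equals $t$ or $\overline{t}$. $(a;q)_\infty=\prod_{i\geq0}(1-aq^i)$, $(a;q)_n=(a;q)_\infty/(aq^n;q)_\infty$; $|q|<1$. $mes_{1,A,a}(\pi)$ is the smallest positive integer $\equiv a\pmod A$ such that no part of $\pi$ has that size. -}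

module Defs where

open import Data.Nat as ℕ using (ℕ; zero; suc; _∸_; _≡ᵇ_; _≤ᵇ_; _<ᵇ_)
open import Data.Nat.Divisibility using (_∣?_)
open import Data.Nat.Combinatorics using (_C_)
open import Data.Integer as ℤ using (ℤ; +_; -_; _^_)
open import Data.Bool using (Bool; true; false; T; _∧_; _∨_; not; if_then_else_)
open import Data.List using (List; []; _∷_; map; foldr; upTo; length)
open import Data.Bool.ListAction using (any)
open import Data.Product using (_×_; _,_; proj₁)
open import Relation.Nullary.Decidable using (⌊_⌋)

-- A part: (size t , overlined?)
Part : Set
Part = ℕ × Bool

-- Adjacent parts (t₁,b₁) followed by (t₂,b₂) are correctly ordered:
-- t₂ < t₁, or t₂ = t₁ and the second copy is not overlined
-- (so only the first occurrence of a value can be overlined).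
adjOK : Part → Part → Bool
adjOK (t₁ , b₁) (t₂ , b₂) = (t₂ <ᵇ t₁) ∨ ((t₂ ≡ᵇ t₁) ∧ not b₂)

sortedOK : List Part → Bool
sortedOK [] = true
sortedOK (p ∷ []) = true
sortedOK (p ∷ p′ ∷ ps) = adjOK p p′ ∧ sortedOK (p′ ∷ ps)

isOverpartition : List Part → Bool
isOverpartition π = foldr (λ p r → (1 ≤ᵇ proj₁ p) ∧ r) true π ∧ sortedOK π

weight : List Part → ℕ
weight π = foldr (λ p r → proj₁ p ℕ.+ r) 0 π

hasSize : ℕ → List Part → Bool
hasSize t π = any (λ p → proj₁ p ≡ᵇ t) π

-- s ≡ a (mod A), valid for 1 ≤ a ≤ A and s ≥ 1:
-- the positive integers ≡ a (mod A) are exactly a, a+A, a+2A, ...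
congB : ℕ → ℕ → ℕ → Bool
congB A a s = (a ≤ᵇ s) ∧ ⌊ A ∣? (s ∸ a) ⌋

mesFrom : ℕ → ℕ → ℕ → List Part → ℕ
mesFrom A zero v π = v
mesFrom A (suc f) v π = if hasSize v π then mesFrom A f (v ℕ.+ A) π else v

-- mes_{1,A,a}(π): smallest positive integer ≡ a (mod A) that is not the
-- size of a part of π (for 1 ≤ a ≤ A).  At most length π candidates can be
-- blocked, so length π + 1 search steps suffice.
mes : ℕ → ℕ → List Part → ℕ
mes A a π = mesFrom A (suc (length π)) a π

property : ℕ → ℕ → List Part → Bool
property A a π =
  any (λ p → not (Data.Product.proj₂ p) ∧ congB A a (proj₁ p) ∧ (proj₁ p <ᵇ mes A a π)) π

PS : Set
PS = ℕ → ℤ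

sumℤ : List ℤ → ℤ
sumℤ = foldr ℤ._+_ (+ 0)

_+ₚ_ : PS → PS → PS
(f +ₚ g) n = f n ℤ.+ g n

_*ₚ_ : PS → PS → PS
(f *ₚ g) n = sumℤ (map (λ i → f i ℤ.* g (n ∸ i)) (upTo (suc n)))

oneₚ : PS
oneₚ n = if n ≡ᵇ 0 then + 1 else + 0

qpow : ℕ → PS
qpow m n = if n ≡ᵇ m then + 1 else + 0

negₚ : PS → PS
negₚ f n = - f n

prodₚ : List PS → PS
prodₚ = foldr _*ₚ_ oneₚ

sumₚ : List PS → PS
sumₚ = foldr _+ₚ_ (λ _ → + 0)

-- 1/(1 - q^m) = Σ_j q^{mj}   (m ≥ 1)
invOneMinus : ℕ → PS
invOneMinus m n = sumℤ (map (λ j → if n ≡ᵇ m ℕ.* j then + 1 else + 0) (upTo (suc n)))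

-- 1/(1 + q^m) = Σ_j (-1)^j q^{mj}   (m ≥ 1)
invOnePlus : ℕ → PS
invOnePlus m n = sumℤ (map (λ j → if n ≡ᵇ m ℕ.* j then (- + 1) ^ j else + 0) (upTo (suc n)))

from1 : ℕ → List ℕ
from1 N = map suc (upTo N)

negQPochInf : ℕ → PS
negQPochInf N = prodₚ (map (λ i → oneₚ +ₚ qpow i) (from1 N))

invQPochInf : ℕ → PS
invQPochInf N = prodₚ (map invOneMinus (from1 N))

summand : ℕ → ℕ → ℕ → PS
summand A a k =
  qpow (A ℕ.* (k C 2) ℕ.+ k ℕ.* a)
  *ₚ (prodₚ (map (λ i → oneₚ +ₚ negₚ (qpow (a ℕ.+ i ℕ.* A))) (upTo (k ∸ 1)))
  *ₚ prodₚ (map (λ i → invOnePlus (a ℕ.+ i ℕ.* A)) (upTo (k ∸ 1))))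

-- Factors with index > n and summands with k > n contribute nothing to
-- the coefficient of q^n (each has order > n), so truncating at n is exact.
rhsCoeff : ℕ → ℕ → ℕ → ℤ
rhsCoeff A a n =
  (negQPochInf n *ₚ (invQPochInf n *ₚ sumₚ (map (summand A a) (from1 n)))) n

-- Write x i = a + i A and F t = (1 + q^t)/(1 - q^t), the generating function of the parts of
-- size t of an overpartition, so that (-q;q)_∞/(q;q)_∞ = ∏_t F t. As x 0 + ⋯ + x j equals
-- A C(j+1,2) + (j+1) a, the (j+1)-th summand is q^{x j} ∏_{i<j} q^{x i} (1 - q^{x i})/(1 + q^{x i}),
-- and times ∏_t F t it becomes the product over t of q^t for t = x i with i < j, of q^t F t for
-- t = x j, and of F t otherwise. So it counts the overpartitions in which x 0, …, x (j-1) occur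
-- exactly once, overlined, and x j occurs non-overlined: the j-th class. An overpartition with
-- the property lies in exactly one class, that of the least j such that x j occurs
-- non-overlined: all of x 0, …, x j are below mes, hence occur, and x i for i < j only
-- overlined. Conversely, in the j-th class all of x 0, …, x j occur, so mes exceeds x j.
-- The coefficients are compared inside a finite product over the sizes up to a bound, where
-- an overpartition is encoded by what it contains at each size.

module Submission where

open import Defs
open import Data.Nat as ℕ
  using (ℕ; zero; suc; _≤_; _<_; _∸_; _≡ᵇ_; _<ᵇ_; _≤ᵇ_; z≤n; s≤s)
import Data.Nat.Properties as ℕP
open import Algebra.Properties.CommutativeSemigroup ℕP.+-commutativeSemigroup using (x∙yz≈y∙xz)
open import Data.Integer as ℤ using (ℤ; +_; -_; _+_; _*_)
import Data.Integer.Properties as ℤP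
open import Data.Integer.Solver using (module +-*-Solver)
open import Data.Nat.Tactic.RingSolver using (solve-∀)
open import Data.Nat.Combinatorics using (_C_; nCk+nC[k+1]≡[n+1]C[k+1]; nC1≡n)
open import Data.List using (List; []; _∷_; _∷ʳ_; map; foldr; upTo; applyUpTo; _++_; length; replicate)
import Data.List.Properties as LP
open import Data.List.Membership.Propositional using (_∈_; find; lose)
open import Data.List.Relation.Unary.Any as Any using (here; there)
open import Data.List.Relation.Unary.All as All using (All; []; _∷_)
import Data.List.Relation.Unary.All.Properties as All
open import Data.List.Relation.Unary.Any.Properties using (any⁺; any⁻)
open import Data.Bool using (Bool; true; false; if_then_else_; T; _∧_; _∨_; not)
open import Data.Bool.Properties as BP using (T-≡; T-∧; T-∨; T-irrelevant)
open import Data.Bool.ListAction using (any)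
open import Data.Product using (Σ; _,_; _×_; proj₁; proj₂)
open import Data.Sum using (_⊎_; inj₁; inj₂; [_,_])
open import Data.Sum.Function.Propositional using (_⊎-↔_)
open import Data.Product.Function.NonDependent.Propositional using (_×-↔_)
open import Data.Unit using (⊤; tt)
open import Data.Empty using (⊥-elim)
open import Data.Fin as Fin using (Fin)
import Data.Fin.Properties as FinP
open import Function using (_∘_)
open import Function.Bundles using (_↔_; Inverse; Equivalence; mk↔ₛ′)
open import Function.Properties.Inverse using (↔-trans)
open import Relation.Nullary using (¬_; contradiction; Irrelevant)
open import Relation.Nullary.Decidable using (isYes≗does; dec-true; toWitness)
open import Relation.Binary.Definitions using (tri<; tri≈; tri>)
open import Data.Nat.Divisibility using (divides; _∣?_)
open import Relation.Binary.PropositionalEquality hiding ([_])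

-- Formal power series

Σ< : ℕ → (ℕ → ℤ) → ℤ
Σ< zero F = + 0
Σ< (suc n) F = F 0 + Σ< n (F ∘ suc)

sumℤ-map-upTo : ∀ n (F : ℕ → ℤ) → sumℤ (map F (upTo n)) ≡ Σ< n F
sumℤ-map-upTo n F = trans (cong sumℤ (LP.map-upTo F n)) (go n F)
  where
  go : ∀ n (F : ℕ → ℤ) → sumℤ (applyUpTo F n) ≡ Σ< n F
  go zero F = refl
  go (suc n) F = cong (λ u → F 0 + u) (go n (F ∘ suc))

Σ<-cong : ∀ N {F G} → (∀ j → F j ≡ G j) → Σ< N F ≡ Σ< N G
Σ<-cong zero e = refl
Σ<-cong (suc N) e = cong₂ _+_ (e 0) (Σ<-cong N (e ∘ suc))

Σ<-zero : ∀ N {F} → (∀ j → F j ≡ + 0) → Σ< N F ≡ + 0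
Σ<-zero N e = trans (Σ<-cong N e) (go N)
  where
  go : ∀ N → Σ< N (λ _ → + 0) ≡ + 0
  go zero = refl
  go (suc N) = trans (ℤP.+-identityˡ _) (go N)

Σ<-+ : ∀ N N′ F → Σ< (N ℕ.+ N′) F ≡ Σ< N F + Σ< N′ (λ j → F (N ℕ.+ j))
Σ<-+ zero N′ F = sym (ℤP.+-identityˡ _)
Σ<-+ (suc N) N′ F =
  trans (cong (λ u → F 0 + u) (Σ<-+ N N′ (F ∘ suc))) (sym (ℤP.+-assoc (F 0) _ _))

Σ<-scale : ∀ N c F → Σ< N (λ j → c * F j) ≡ c * Σ< N F
Σ<-scale zero c F = sym (ℤP.*-zeroʳ c)
Σ<-scale (suc N) c F =
  trans (cong (λ u → c * F 0 + u) (Σ<-scale N c (F ∘ suc))) (sym (ℤP.*-distribˡ-+ c (F 0) _))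

conv : PS → PS → PS
conv f g zero = f 0 * g 0
conv f g (suc n) = f 0 * g (suc n) + conv (f ∘ suc) g n

*ₚ≗conv : ∀ f g → (f *ₚ g) ≗ conv f g
*ₚ≗conv f g n = trans (sumℤ-map-upTo (suc n) (λ i → f i * g (n ∸ i))) (go n f)
  where
  go : ∀ n f → Σ< (suc n) (λ i → f i * g (n ∸ i)) ≡ conv f g n
  go zero f = ℤP.+-identityʳ _
  go (suc n) f = cong (λ u → f 0 * g (suc n) + u) (go n (f ∘ suc))

zeroₚ : PS
zeroₚ _ = + 0

scale : ℤ → PS → PS
scale c f n = c * f n

open +-*-Solver

conv-cong : ∀ {f f′ g g′} → f ≗ f′ → g ≗ g′ → conv f g ≗ conv f′ g′
conv-cong ef eg zero = cong₂ _*_ (ef 0) (eg 0)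
conv-cong ef eg (suc n) =
  cong₂ _+_ (cong₂ _*_ (ef 0) (eg (suc n))) (conv-cong (ef ∘ suc) eg n)

conv-distribʳ : ∀ f g h → conv (f +ₚ g) h ≗ (conv f h +ₚ conv g h)
conv-distribʳ f g h zero = ℤP.*-distribʳ-+ (h 0) (f 0) (g 0)
conv-distribʳ f g h (suc n) = trans
  (cong (λ u → (f 0 + g 0) * h (suc n) + u) (conv-distribʳ (f ∘ suc) (g ∘ suc) h n))
  (solve 5 (λ a b c d e → (a :+ b) :* c :+ (d :+ e) := (a :* c :+ d) :+ (b :* c :+ e))
    refl (f 0) (g 0) (h (suc n)) (conv (f ∘ suc) h n) (conv (g ∘ suc) h n))

conv-distribˡ : ∀ f g h → conv f (g +ₚ h) ≗ (conv f g +ₚ conv f h)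
conv-distribˡ f g h zero = ℤP.*-distribˡ-+ (f 0) (g 0) (h 0)
conv-distribˡ f g h (suc n) = trans
  (cong (λ u → f 0 * (g (suc n) + h (suc n)) + u) (conv-distribˡ (f ∘ suc) g h n))
  (solve 5 (λ a b c d e → a :* (b :+ c) :+ (d :+ e) := (a :* b :+ d) :+ (a :* c :+ e))
    refl (f 0) (g (suc n)) (h (suc n)) (conv (f ∘ suc) g n) (conv (f ∘ suc) h n))

conv-scaleˡ : ∀ c f g → conv (scale c f) g ≗ scale c (conv f g)
conv-scaleˡ c f g zero = ℤP.*-assoc c (f 0) (g 0)
conv-scaleˡ c f g (suc n) = trans
  (cong (λ u → c * f 0 * g (suc n) + u) (conv-scaleˡ c (f ∘ suc) g n))
  (solve 4 (λ a b d e → a :* b :* d :+ a :* e := a :* (b :* d :+ e))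
    refl c (f 0) (g (suc n)) (conv (f ∘ suc) g n))

conv-zeroˡ-upTo : ∀ f g n → (∀ l → l ≤ n → f l ≡ + 0) → conv f g n ≡ + 0
conv-zeroˡ-upTo f g zero h rewrite h 0 z≤n = refl
conv-zeroˡ-upTo f g (suc n) h
  rewrite h 0 z≤n | conv-zeroˡ-upTo (f ∘ suc) g n (λ l le → h (suc l) (s≤s le)) = refl

conv-zeroʳ : ∀ f n → conv f zeroₚ n ≡ + 0
conv-zeroʳ f zero = ℤP.*-zeroʳ (f 0)
conv-zeroʳ f (suc n) rewrite conv-zeroʳ (f ∘ suc) n = cong (_+ + 0) (ℤP.*-zeroʳ (f 0))

conv-suc : ∀ f g n → conv f g (suc n) ≡ conv f (g ∘ suc) n + f (suc n) * g 0
conv-suc f g zero = refl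
conv-suc f g (suc n) = trans (cong (λ u → f 0 * g (suc (suc n)) + u) (conv-suc (f ∘ suc) g n))
  (sym (ℤP.+-assoc (f 0 * g (suc (suc n))) _ _))

conv-comm : ∀ f g → conv f g ≗ conv g f
conv-comm f g zero = ℤP.*-comm (f 0) (g 0)
conv-comm f g (suc n) = begin
  f 0 * g (suc n) + conv (f ∘ suc) g n
    ≡⟨ cong (λ u → f 0 * g (suc n) + u) (conv-comm (f ∘ suc) g n) ⟩
  f 0 * g (suc n) + conv g (f ∘ suc) n
    ≡⟨ solve 3 (λ a b c → a :* b :+ c := c :+ b :* a) refl (f 0) (g (suc n)) (conv g (f ∘ suc) n) ⟩
  conv g (f ∘ suc) n + g (suc n) * f 0  ≡⟨ sym (conv-suc g f n) ⟩
  conv g f (suc n)                      ∎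
  where open ≡-Reasoning

conv-assoc : ∀ f g h → conv (conv f g) h ≗ conv f (conv g h)
conv-assoc f g h zero = ℤP.*-assoc (f 0) (g 0) (h 0)
conv-assoc f g h (suc n) = begin
  f 0 * g 0 * h (suc n) + conv (scale (f 0) (g ∘ suc) +ₚ conv (f ∘ suc) g) h n
    ≡⟨ cong (λ u → f 0 * g 0 * h (suc n) + u)
         (conv-distribʳ (scale (f 0) (g ∘ suc)) (conv (f ∘ suc) g) h n) ⟩
  f 0 * g 0 * h (suc n) + (conv (scale (f 0) (g ∘ suc)) h n + conv (conv (f ∘ suc) g) h n)
    ≡⟨ cong₂ (λ u v → f 0 * g 0 * h (suc n) + (u + v))
         (conv-scaleˡ (f 0) (g ∘ suc) h n) (conv-assoc (f ∘ suc) g h n) ⟩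
  f 0 * g 0 * h (suc n) + (f 0 * conv (g ∘ suc) h n + conv (f ∘ suc) (conv g h) n)
    ≡⟨ solve 5 (λ a b c d e → a :* b :* c :+ (a :* d :+ e) := a :* (b :* c :+ d) :+ e)
         refl (f 0) (g 0) (h (suc n)) (conv (g ∘ suc) h n) (conv (f ∘ suc) (conv g h) n) ⟩
  f 0 * (g 0 * h (suc n) + conv (g ∘ suc) h n) + conv (f ∘ suc) (conv g h) n ∎
  where open ≡-Reasoning

conv-oneˡ-upTo : ∀ f g n → (∀ l → l ≤ n → f l ≡ oneₚ l) → conv f g n ≡ g n
conv-oneˡ-upTo f g zero h rewrite h 0 z≤n = ℤP.*-identityˡ (g 0)
conv-oneˡ-upTo f g (suc n) h
  rewrite h 0 z≤n | conv-zeroˡ-upTo (f ∘ suc) g n (λ l le → h (suc l) (s≤s le)) =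
  trans (ℤP.+-identityʳ _) (ℤP.*-identityˡ (g (suc n)))

-- a record rather than _≗_, so that the series can be inferred from a proof of f ≈ g
infix 4 _≈_
record _≈_ (f g : PS) : Set where
  constructor mk≈
  field at : f ≗ g
open _≈_ public

≈-refl : ∀ {f} → f ≈ f
≈-refl = mk≈ λ _ → refl

≈-sym : ∀ {f g} → f ≈ g → g ≈ f
≈-sym e = mk≈ λ n → sym (at e n)

≈-trans : ∀ {f g h} → f ≈ g → g ≈ h → f ≈ h
≈-trans e e′ = mk≈ λ n → trans (at e n) (at e′ n)

≡⇒≈ : ∀ {f g} → f ≡ g → f ≈ g
≡⇒≈ refl = ≈-refl

*ₚ-via-conv : ∀ {f g f′ g′} → conv f g ≗ conv f′ g′ → f *ₚ g ≈ f′ *ₚ g′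
*ₚ-via-conv {f} {g} {f′} {g′} e =
  mk≈ λ n → trans (*ₚ≗conv f g n) (trans (e n) (sym (*ₚ≗conv f′ g′ n)))

*-cong : ∀ {f f′ g g′} → f ≈ f′ → g ≈ g′ → f *ₚ g ≈ f′ *ₚ g′
*-cong ef eg = *ₚ-via-conv (conv-cong (at ef) (at eg))

*-congˡ : ∀ f {g g′} → g ≈ g′ → f *ₚ g ≈ f *ₚ g′
*-congˡ f = *-cong (≈-refl {f})

*-congʳ : ∀ {f f′} g → f ≈ f′ → f *ₚ g ≈ f′ *ₚ g
*-congʳ g ef = *-cong ef (≈-refl {g})

+-cong : ∀ {f f′ g g′} → f ≈ f′ → g ≈ g′ → f +ₚ g ≈ f′ +ₚ g′
+-cong ef eg = mk≈ λ n → cong₂ _+_ (at ef n) (at eg n)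

*-comm : ∀ f g → f *ₚ g ≈ g *ₚ f
*-comm f g = *ₚ-via-conv (conv-comm f g)

*-assoc : ∀ f g h → (f *ₚ g) *ₚ h ≈ f *ₚ (g *ₚ h)
*-assoc f g h = mk≈ λ n → begin
  ((f *ₚ g) *ₚ h) n    ≡⟨ *ₚ≗conv (f *ₚ g) h n ⟩
  conv (f *ₚ g) h n    ≡⟨ conv-cong (*ₚ≗conv f g) (λ _ → refl) n ⟩
  conv (conv f g) h n  ≡⟨ conv-assoc f g h n ⟩
  conv f (conv g h) n  ≡⟨ conv-cong (λ _ → refl) (λ k → sym (*ₚ≗conv g h k)) n ⟩
  conv f (g *ₚ h) n    ≡⟨ sym (*ₚ≗conv f (g *ₚ h) n) ⟩
  (f *ₚ (g *ₚ h)) n    ∎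
  where open ≡-Reasoning

*-identityˡ : ∀ f → oneₚ *ₚ f ≈ f
*-identityˡ f = mk≈ λ n → trans (*ₚ≗conv oneₚ f n) (conv-oneˡ-upTo oneₚ f n λ _ _ → refl)

*-identityʳ : ∀ f → f *ₚ oneₚ ≈ f
*-identityʳ f = ≈-trans (*-comm f oneₚ) (*-identityˡ f)

*-distribʳ-+ : ∀ f g h → (f +ₚ g) *ₚ h ≈ (f *ₚ h) +ₚ (g *ₚ h)
*-distribʳ-+ f g h = mk≈ λ n → trans (*ₚ≗conv (f +ₚ g) h n) (trans (conv-distribʳ f g h n)
  (sym (cong₂ _+_ (*ₚ≗conv f h n) (*ₚ≗conv g h n))))

*-distribˡ-+ : ∀ f g h → f *ₚ (g +ₚ h) ≈ (f *ₚ g) +ₚ (f *ₚ h)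
*-distribˡ-+ f g h = mk≈ λ n → trans (*ₚ≗conv f (g +ₚ h) n) (trans (conv-distribˡ f g h n)
  (sym (cong₂ _+_ (*ₚ≗conv f g n) (*ₚ≗conv f h n))))

*-zeroʳ : ∀ f → f *ₚ zeroₚ ≈ zeroₚ
*-zeroʳ f = mk≈ λ n → trans (*ₚ≗conv f zeroₚ n) (conv-zeroʳ f n)

*-negˡ : ∀ f g → negₚ f *ₚ g ≈ negₚ (f *ₚ g)
*-negˡ f g = mk≈ λ n → begin
  (negₚ f *ₚ g) n             ≡⟨ *ₚ≗conv (negₚ f) g n ⟩
  conv (negₚ f) g n           ≡⟨ conv-cong (λ k → sym (ℤP.-1*i≡-i (f k))) (λ _ → refl) n ⟩
  conv (scale (- + 1) f) g n  ≡⟨ conv-scaleˡ (- + 1) f g n ⟩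
  - + 1 * conv f g n          ≡⟨ ℤP.-1*i≡-i _ ⟩
  - conv f g n                ≡⟨ cong -_ (sym (*ₚ≗conv f g n)) ⟩
  - (f *ₚ g) n                ∎
  where open ≡-Reasoning

*-interchange : ∀ f g h k → (f *ₚ g) *ₚ (h *ₚ k) ≈ (f *ₚ h) *ₚ (g *ₚ k)
*-interchange f g h k =
  ≈-trans (*-assoc f g (h *ₚ k))
  (≈-trans (*-congˡ f (≈-trans (≈-sym (*-assoc g h k))
                      (≈-trans (*-congʳ k (*-comm g h)) (*-assoc h g k))))
  (≈-sym (*-assoc f h (g *ₚ k))))

*-left-comm : ∀ f g h → f *ₚ (g *ₚ h) ≈ g *ₚ (f *ₚ h)
*-left-comm f g h =
  ≈-trans (≈-sym (*-assoc f g h)) (≈-trans (*-congʳ h (*-comm f g)) (*-assoc g f h))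

qpow-*-below : ∀ m g n → n < m → (qpow m *ₚ g) n ≡ + 0
qpow-*-below m g n n<m = trans (*ₚ≗conv (qpow m) g n) (go m n n<m)
  where
  go : ∀ m n → n < m → conv (qpow m) g n ≡ + 0
  go (suc m) zero _ = ℤP.*-zeroˡ (g 0)
  go (suc m) (suc n) (s≤s n<m) =
    trans (cong (_+ conv (qpow m) g n) (ℤP.*-zeroˡ (g (suc n))))
          (trans (ℤP.+-identityˡ _) (go m n n<m))

qpow-*-shift : ∀ m g k → (qpow m *ₚ g) (m ℕ.+ k) ≡ g k
qpow-*-shift m g k = trans (*ₚ≗conv (qpow m) g (m ℕ.+ k)) (go m)
  where
  go : ∀ m → conv (qpow m) g (m ℕ.+ k) ≡ g k
  go zero = conv-oneˡ-upTo oneₚ g k λ _ _ → refl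
  go (suc m) = trans (cong (_+ conv (qpow m) g (m ℕ.+ k)) (ℤP.*-zeroˡ (g (suc (m ℕ.+ k)))))
                     (trans (ℤP.+-identityˡ _) (go m))

below-or-shift : ∀ m n → n < m ⊎ Σ ℕ (λ k → n ≡ m ℕ.+ k)
below-or-shift m n with ℕP.<-≤-connex n m
... | inj₁ n<m = inj₁ n<m
... | inj₂ m≤n = inj₂ (n ∸ m , sym (ℕP.m+[n∸m]≡n m≤n))

qpow-+ : ∀ m m′ → qpow m *ₚ qpow m′ ≈ qpow (m ℕ.+ m′)
qpow-+ m m′ = mk≈ λ n → go n (below-or-shift m n)
  where
  below : ∀ m n → n < m → + 0 ≡ qpow (m ℕ.+ m′) n
  below (suc m) zero _ = refl
  below (suc m) (suc n) (s≤s n<m) = below m n n<m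
  shift : ∀ m k → qpow m′ k ≡ qpow (m ℕ.+ m′) (m ℕ.+ k)
  shift zero k = refl
  shift (suc m) k = shift m k
  go : ∀ n → n < m ⊎ Σ ℕ (λ k → n ≡ m ℕ.+ k) →
       (qpow m *ₚ qpow m′) n ≡ qpow (m ℕ.+ m′) n
  go n (inj₁ n<m) = trans (qpow-*-below m (qpow m′) n n<m) (below m n n<m)
  go _ (inj₂ (k , refl)) = trans (qpow-*-shift m (qpow m′) k) (shift m k)

geomSum : ℕ → (ℕ → ℤ) → ℕ → ℕ → ℤ
geomSum m h N n = Σ< N (λ j → if n ≡ᵇ m ℕ.* j then h j else + 0)

invOneMinus≡geomSum : ∀ m n → invOneMinus m n ≡ geomSum m (λ _ → + 1) (suc n) n
invOneMinus≡geomSum m n = sumℤ-map-upTo (suc n) (λ j → if n ≡ᵇ m ℕ.* j then + 1 else + 0)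

invOnePlus≡geomSum : ∀ m n → invOnePlus m n ≡ geomSum m (λ j → (- + 1) ℤ.^ j) (suc n) n
invOnePlus≡geomSum m n =
  sumℤ-map-upTo (suc n) (λ j → if n ≡ᵇ m ℕ.* j then (- + 1) ℤ.^ j else + 0)

≢⇒≡ᵇ-false : ∀ {m n} → m ≢ n → (m ≡ᵇ n) ≡ false
≢⇒≡ᵇ-false {m} {n} m≢n with m ≡ᵇ n in eq
... | false = refl
... | true = contradiction (ℕP.≡ᵇ⇒≡ m n (Equivalence.from T-≡ eq)) m≢n

module _ (m : ℕ) (h : ℕ → ℤ) where

  geomSum-zero : ∀ N → geomSum (suc m) h (suc N) 0 ≡ h 0
  geomSum-zero N rewrite ℕP.*-zeroʳ m =
    trans (cong (λ u → h 0 + u) (Σ<-zero N λ _ → refl)) (ℤP.+-identityʳ (h 0))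

  geomSum-below : ∀ N n → n ≢ 0 → n < suc m → geomSum (suc m) h N n ≡ + 0
  geomSum-below N n n≢0 n<m =
    Σ<-zero N λ j → cong (λ b → if b then h j else + 0) (≢⇒≡ᵇ-false (≢mj j))
    where
    ≢mj : ∀ j → n ≢ suc m ℕ.* j
    ≢mj zero e = n≢0 (trans e (ℕP.*-zeroʳ m))
    ≢mj (suc j) = ℕP.<⇒≢ (ℕP.<-≤-trans n<m (ℕP.m≤m*n (suc m) (suc j)))

  geomSum-truncate : ∀ d n → geomSum (suc m) h (suc n ℕ.+ d) n ≡ geomSum (suc m) h (suc n) n
  geomSum-truncate d n =
    trans (Σ<-+ (suc n) d (λ j → if n ≡ᵇ suc m ℕ.* j then h j else + 0))
    (trans (cong (λ u → geomSum (suc m) h (suc n) n + u) (Σ<-zero d λ j →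
             cong (λ b → if b then h (suc n ℕ.+ j) else + 0) (≢⇒≡ᵇ-false (≢mj j))))
           (ℤP.+-identityʳ _))
    where
    ≢mj : ∀ j → n ≢ suc m ℕ.* (suc n ℕ.+ j)
    ≢mj j = ℕP.<⇒≢ (ℕP.<-≤-trans (ℕP.n<1+n n)
              (ℕP.≤-trans (ℕP.m≤m+n (suc n) j) (ℕP.m≤n*m (suc n ℕ.+ j) (suc m))))

≡ᵇ-+-cancelˡ : ∀ i m n → (i ℕ.+ m ≡ᵇ i ℕ.+ n) ≡ (m ≡ᵇ n)
≡ᵇ-+-cancelˡ zero m n = refl
≡ᵇ-+-cancelˡ (suc i) m n = ≡ᵇ-+-cancelˡ i m n

geomSum-shift : ∀ m h k →
  geomSum (suc m) h (suc (suc m ℕ.+ k)) (suc m ℕ.+ k) ≡ geomSum (suc m) (h ∘ suc) (suc k) k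
geomSum-shift m h k = begin
  geomSum (suc m) h (suc (suc m ℕ.+ k)) (suc m ℕ.+ k)
    ≡⟨ cong (λ z → (if suc m ℕ.+ k ≡ᵇ z then h 0 else + 0) + Σ< (suc m ℕ.+ k) F)
         (ℕP.*-zeroʳ m) ⟩
  + 0 + Σ< (suc m ℕ.+ k) (λ j → if suc m ℕ.+ k ≡ᵇ suc m ℕ.* suc j then h (suc j) else + 0)
    ≡⟨ ℤP.+-identityˡ _ ⟩
  Σ< (suc m ℕ.+ k) (λ j → if suc m ℕ.+ k ≡ᵇ suc m ℕ.* suc j then h (suc j) else + 0)
    ≡⟨ Σ<-cong (suc m ℕ.+ k) (λ j → cong (λ b → if b then h (suc j) else + 0) (cancel j)) ⟩
  geomSum (suc m) (h ∘ suc) (suc m ℕ.+ k) k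
    ≡⟨ cong (λ N → geomSum (suc m) (h ∘ suc) N k) (cong suc (ℕP.+-comm m k)) ⟩
  geomSum (suc m) (h ∘ suc) (suc k ℕ.+ m) k
    ≡⟨ geomSum-truncate m (h ∘ suc) m k ⟩
  geomSum (suc m) (h ∘ suc) (suc k) k ∎
  where
  open ≡-Reasoning
  F : ℕ → ℤ
  F j = if suc m ℕ.+ k ≡ᵇ suc m ℕ.* suc j then h (suc j) else + 0
  cancel : ∀ j → (suc m ℕ.+ k ≡ᵇ suc m ℕ.* suc j) ≡ (k ≡ᵇ suc m ℕ.* j)
  cancel j = trans (cong (λ u → suc m ℕ.+ k ≡ᵇ u) (ℕP.*-suc (suc m) j))
                   (≡ᵇ-+-cancelˡ (suc m) k _)

oneMinus onePlus : ℕ → PS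
oneMinus t = oneₚ +ₚ negₚ (qpow t)
onePlus t = oneₚ +ₚ qpow t

module _ (m : ℕ) where

  private
    G⁻ G⁺ : PS
    G⁻ = invOneMinus (suc m)
    G⁺ = invOnePlus (suc m)
    one sign : ℕ → ℤ
    one _ = + 1
    sign j = (- + 1) ℤ.^ j

  invOneMinus-shift : ∀ k → G⁻ (suc m ℕ.+ k) ≡ G⁻ k
  invOneMinus-shift k = begin
    G⁻ (suc m ℕ.+ k)                                     ≡⟨ invOneMinus≡geomSum (suc m) (suc m ℕ.+ k) ⟩
    geomSum (suc m) one (suc (suc m ℕ.+ k)) (suc m ℕ.+ k) ≡⟨ geomSum-shift m one k ⟩
    geomSum (suc m) one (suc k) k                         ≡⟨ sym (invOneMinus≡geomSum (suc m) k) ⟩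
    G⁻ k                                                 ∎
    where open ≡-Reasoning

  invOnePlus-shift : ∀ k → G⁺ (suc m ℕ.+ k) ≡ - G⁺ k
  invOnePlus-shift k = begin
    G⁺ (suc m ℕ.+ k)                                       ≡⟨ invOnePlus≡geomSum (suc m) (suc m ℕ.+ k) ⟩
    geomSum (suc m) sign (suc (suc m ℕ.+ k)) (suc m ℕ.+ k) ≡⟨ geomSum-shift m sign k ⟩
    geomSum (suc m) (λ j → - + 1 * sign j) (suc k) k
      ≡⟨ Σ<-cong (suc k) (λ j → pull (k ≡ᵇ suc m ℕ.* j) (sign j)) ⟩
    Σ< (suc k) (λ j → - + 1 * T⁺ j)                        ≡⟨ Σ<-scale (suc k) (- + 1) T⁺ ⟩
    - + 1 * geomSum (suc m) sign (suc k) k                 ≡⟨ ℤP.-1*i≡-i _ ⟩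
    - geomSum (suc m) sign (suc k) k                       ≡⟨ cong -_ (sym (invOnePlus≡geomSum (suc m) k)) ⟩
    - G⁺ k                                                 ∎
    where
    open ≡-Reasoning
    T⁺ : ℕ → ℤ
    T⁺ j = if k ≡ᵇ suc m ℕ.* j then sign j else + 0
    pull : ∀ b z → (if b then - + 1 * z else + 0) ≡ - + 1 * (if b then z else + 0)
    pull true z = refl
    pull false z = refl

  oneMinus-*-invOneMinus : oneMinus (suc m) *ₚ G⁻ ≈ oneₚ
  oneMinus-*-invOneMinus = ≈-trans (*-distribʳ-+ oneₚ (negₚ (qpow (suc m))) G⁻)
    (≈-trans (+-cong (*-identityˡ G⁻) (*-negˡ (qpow (suc m)) G⁻))
    (mk≈ λ n → go n (below-or-shift (suc m) n)))
    where
    go : ∀ n → n < suc m ⊎ Σ ℕ (λ k → n ≡ suc m ℕ.+ k) →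
         G⁻ n + - (qpow (suc m) *ₚ G⁻) n ≡ oneₚ n
    go zero (inj₁ n<m) rewrite qpow-*-below (suc m) G⁻ zero n<m =
      trans (ℤP.+-identityʳ (G⁻ 0)) (trans (invOneMinus≡geomSum (suc m) 0) (geomSum-zero m one 0))
    go (suc n) (inj₁ n<m) rewrite qpow-*-below (suc m) G⁻ (suc n) n<m =
      trans (ℤP.+-identityʳ _) (trans (invOneMinus≡geomSum (suc m) (suc n))
        (geomSum-below m one (suc (suc n)) (suc n) (λ ()) n<m))
    go _ (inj₂ (k , refl)) rewrite invOneMinus-shift k | qpow-*-shift (suc m) G⁻ k =
      ℤP.+-inverseʳ (G⁻ k)

  onePlus-*-invOnePlus : onePlus (suc m) *ₚ G⁺ ≈ oneₚ
  onePlus-*-invOnePlus = ≈-trans (*-distribʳ-+ oneₚ (qpow (suc m)) G⁺)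
    (≈-trans (+-cong (*-identityˡ G⁺) (≈-refl {qpow (suc m) *ₚ G⁺}))
    (mk≈ λ n → go n (below-or-shift (suc m) n)))
    where
    go : ∀ n → n < suc m ⊎ Σ ℕ (λ k → n ≡ suc m ℕ.+ k) →
         G⁺ n + (qpow (suc m) *ₚ G⁺) n ≡ oneₚ n
    go zero (inj₁ n<m) rewrite qpow-*-below (suc m) G⁺ zero n<m =
      trans (ℤP.+-identityʳ (G⁺ 0)) (trans (invOnePlus≡geomSum (suc m) 0) (geomSum-zero m sign 0))
    go (suc n) (inj₁ n<m) rewrite qpow-*-below (suc m) G⁺ (suc n) n<m =
      trans (ℤP.+-identityʳ _) (trans (invOnePlus≡geomSum (suc m) (suc n))
        (geomSum-below m sign (suc (suc n)) (suc n) (λ ()) n<m))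
    go _ (inj₂ (k , refl)) rewrite invOnePlus-shift k | qpow-*-shift (suc m) G⁺ k =
      ℤP.+-inverseˡ (G⁺ k)

sizes : ℕ → List ℕ
sizes zero = []
sizes (suc M) = suc M ∷ sizes M

prodₚ-++ : ∀ fs gs → prodₚ (fs ++ gs) ≈ prodₚ fs *ₚ prodₚ gs
prodₚ-++ [] gs = ≈-sym (*-identityˡ (prodₚ gs))
prodₚ-++ (f ∷ fs) gs =
  ≈-trans (*-congˡ f (prodₚ-++ fs gs)) (≈-sym (*-assoc f (prodₚ fs) (prodₚ gs)))

prodₚ-snoc : ∀ fs g → prodₚ (fs ∷ʳ g) ≈ prodₚ fs *ₚ g
prodₚ-snoc fs g = ≈-trans (prodₚ-++ fs (g ∷ [])) (*-congˡ (prodₚ fs) (*-identityʳ g))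

prodₚ-upTo-suc : ∀ (Φ : ℕ → PS) j →
  prodₚ (map Φ (upTo (suc j))) ≈ prodₚ (map Φ (upTo j)) *ₚ Φ j
prodₚ-upTo-suc Φ j = ≈-trans (≡⇒≈ (cong prodₚ (trans (cong (map Φ) (sym (LP.upTo-∷ʳ j)))
                                                   (LP.map-++ Φ (upTo j) (j ∷ [])))))
                             (prodₚ-snoc (map Φ (upTo j)) (Φ j))

prodₚ-from1 : ∀ (Φ : ℕ → PS) n → prodₚ (map Φ (from1 n)) ≈ prodₚ (map Φ (sizes n))
prodₚ-from1 Φ zero = ≈-refl
prodₚ-from1 Φ (suc n) =
  ≈-trans (≡⇒≈ (cong prodₚ (trans (cong (map Φ) from1-suc) (LP.map-++ Φ (from1 n) (suc n ∷ [])))))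
  (≈-trans (prodₚ-snoc (map Φ (from1 n)) (Φ (suc n)))
  (≈-trans (*-congʳ (Φ (suc n)) (prodₚ-from1 Φ n)) (*-comm (prodₚ (map Φ (sizes n))) (Φ (suc n)))))
  where
  from1-suc : from1 (suc n) ≡ from1 n ∷ʳ suc n
  from1-suc = trans (cong (map suc) (sym (LP.upTo-∷ʳ n))) (LP.map-++ suc (upTo n) (n ∷ []))

prodₚ-map-* : ∀ (F G : ℕ → PS) L →
  prodₚ (map (λ t → F t *ₚ G t) L) ≈ prodₚ (map F L) *ₚ prodₚ (map G L)
prodₚ-map-* F G [] = ≈-sym (*-identityˡ oneₚ)
prodₚ-map-* F G (t ∷ L) = ≈-trans (*-congˡ (F t *ₚ G t) (prodₚ-map-* F G L))
  (*-interchange (F t) (G t) (prodₚ (map F L)) (prodₚ (map G L)))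

*-sumₚ : ∀ f (G : ℕ → PS) L → f *ₚ sumₚ (map G L) ≈ sumₚ (map (λ k → f *ₚ G k) L)
*-sumₚ f G [] = *-zeroʳ f
*-sumₚ f G (k ∷ L) =
  ≈-trans (*-distribˡ-+ f (G k) (sumₚ (map G L))) (+-cong (≈-refl {f *ₚ G k}) (*-sumₚ f G L))

prodₚ-sizes-cong : ∀ (G G′ : ℕ → PS) M → (∀ t → 1 ≤ t → t ≤ M → G t ≈ G′ t) →
  prodₚ (map G (sizes M)) ≈ prodₚ (map G′ (sizes M))
prodₚ-sizes-cong G G′ zero e = ≈-refl
prodₚ-sizes-cong G G′ (suc M) e =
  *-cong (e (suc M) (s≤s z≤n) ℕP.≤-refl)
         (prodₚ-sizes-cong G G′ M (λ t 1≤t t≤M → e t 1≤t (ℕP.m≤n⇒m≤1+n t≤M)))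

prodₚ-sizes-* : ∀ (G G′ : ℕ → PS) h c M → 1 ≤ c → c ≤ M →
  (∀ t → 1 ≤ t → t ≤ M → t ≢ c → G′ t ≈ G t) → G′ c ≈ G c *ₚ h →
  prodₚ (map G (sizes M)) *ₚ h ≈ prodₚ (map G′ (sizes M))
prodₚ-sizes-* G G′ h c zero 1≤c c≤0 = contradiction (ℕP.≤-trans 1≤c c≤0) λ ()
prodₚ-sizes-* G G′ h c (suc M) 1≤c c≤M e ec with ℕP.m≤n⇒m<n∨m≡n c≤M
... | inj₂ refl =
  ≈-trans (*-assoc (G (suc M)) _ h)
  (≈-trans (*-congˡ (G (suc M)) (*-comm (prodₚ (map G (sizes M))) h))
  (≈-trans (≈-sym (*-assoc (G (suc M)) h _))
  (*-cong (≈-sym ec) (prodₚ-sizes-cong G G′ M λ t 1≤t t≤M →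
    ≈-sym (e t 1≤t (ℕP.m≤n⇒m≤1+n t≤M) (ℕP.<⇒≢ (s≤s t≤M)))))))
... | inj₁ (s≤s c≤M′) =
  ≈-trans (*-assoc (G (suc M)) _ h)
  (*-cong (≈-sym (e (suc M) (s≤s z≤n) ℕP.≤-refl (ℕP.>⇒≢ (s≤s c≤M′))))
          (prodₚ-sizes-* G G′ h c M 1≤c c≤M′ (λ t 1≤t t≤M → e t 1≤t (ℕP.m≤n⇒m≤1+n t≤M))
                          ec))

-- (1 + q^t)/(1 - q^t): the generating function of the parts of size t of an overpartition
ovFactor : ℕ → PS
ovFactor t = onePlus t *ₚ invOneMinus t

ovGF : ℕ → PS
ovGF M = prodₚ (map ovFactor (sizes M))

ovFactor-below : ∀ m l → l < suc m → ovFactor (suc m) l ≡ oneₚ l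
ovFactor-below m l l<m = begin
  ovFactor (suc m) l                          ≡⟨ at (*-distribʳ-+ oneₚ (qpow (suc m)) G) l ⟩
  (oneₚ *ₚ G) l + (qpow (suc m) *ₚ G) l
    ≡⟨ cong₂ _+_ (at (*-identityˡ G) l) (qpow-*-below (suc m) G l l<m) ⟩
  G l + + 0                                    ≡⟨ ℤP.+-identityʳ (G l) ⟩
  G l                                          ≡⟨ go l l<m ⟩
  oneₚ l                                       ∎
  where
  open ≡-Reasoning
  G = invOneMinus (suc m)
  go : ∀ l → l < suc m → G l ≡ oneₚ l
  go zero _ = trans (invOneMinus≡geomSum (suc m) 0) (geomSum-zero m (λ _ → + 1) 0)
  go (suc l) l<m = trans (invOneMinus≡geomSum (suc m) (suc l))
                         (geomSum-below m (λ _ → + 1) (suc (suc l)) (suc l) (λ ()) l<m)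

ovGF-stable : ∀ S n d i → i ≤ n → (ovGF (d ℕ.+ n) *ₚ S) i ≡ (ovGF n *ₚ S) i
ovGF-stable S n zero i i≤n = refl
ovGF-stable S n (suc d) i i≤n = begin
  (ovGF (suc d ℕ.+ n) *ₚ S) i
    ≡⟨ at (*-assoc (ovFactor (suc (d ℕ.+ n))) (ovGF (d ℕ.+ n)) S) i ⟩
  (ovFactor (suc (d ℕ.+ n)) *ₚ P) i  ≡⟨ *ₚ≗conv (ovFactor (suc (d ℕ.+ n))) P i ⟩
  conv (ovFactor (suc (d ℕ.+ n))) P i
    ≡⟨ conv-oneˡ-upTo (ovFactor (suc (d ℕ.+ n))) P i (λ l l≤i →
         ovFactor-below (d ℕ.+ n) l
           (s≤s (ℕP.≤-trans l≤i (ℕP.≤-trans i≤n (ℕP.m≤n+m n d))))) ⟩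
  P i                                ≡⟨ ovGF-stable S n d i i≤n ⟩
  (ovGF n *ₚ S) i                    ∎
  where
  open ≡-Reasoning
  P = ovGF (d ℕ.+ n) *ₚ S

ratio : ℕ → PS
ratio t = oneMinus t *ₚ invOnePlus t

ovFactor-*-ratio : ∀ t → 1 ≤ t → ovFactor t *ₚ ratio t ≈ oneₚ
ovFactor-*-ratio (suc m) _ =
  ≈-trans (*-congˡ (onePlus t *ₚ invOneMinus t) (*-comm (oneMinus t) (invOnePlus t)))
  (≈-trans (*-interchange (onePlus t) (invOneMinus t) (invOnePlus t) (oneMinus t))
  (≈-trans (*-congˡ (onePlus t *ₚ invOnePlus t) (*-comm (invOneMinus t) (oneMinus t)))
  (≈-trans (*-cong (onePlus-*-invOnePlus m) (oneMinus-*-invOneMinus m)) (*-identityˡ oneₚ))))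
  where t = suc m

-- Generating functions of weighted sets

Σ-≡-irr : ∀ {X : Set} {P : X → Set} → (∀ x → Irrelevant (P x)) →
  ∀ {x x′ p p′} → x ≡ x′ → _≡_ {A = Σ X P} (x , p) (x′ , p′)
Σ-≡-irr irr {x} {p = p} {p′} refl = cong (x ,_) (irr x p p′)

IsGF : PS → (X : Set) → (X → ℕ) → Set
IsGF f X w = ∀ n → Σ ℕ λ m → (f n ≡ + m) × (Fin m ↔ Σ X (λ x → w x ≡ n))

Fin1↔ : ∀ {P : Set} → Irrelevant P → P → Fin 1 ↔ P
Fin1↔ irr p = mk↔ₛ′ (λ _ → p) (λ _ → Fin.zero) (irr p) λ { Fin.zero → refl ; (Fin.suc ()) }

Fin0↔ : ∀ {P : Set} → ¬ P → Fin 0 ↔ P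
Fin0↔ ¬p = mk↔ₛ′ (λ ()) (⊥-elim ∘ ¬p) (⊥-elim ∘ ¬p) (λ ())

IsGF-≈ : ∀ {f g X w} → g ≈ f → IsGF f X w → IsGF g X w
IsGF-≈ e gf n with gf n
... | m , fn≡m , count = m , trans (at e n) fn≡m , count

IsGF-↔ : ∀ {f X Y w w′} (e : X ↔ Y) → (∀ x → w′ (Inverse.to e x) ≡ w x) →
  IsGF f X w → IsGF f Y w′
IsGF-↔ {w = w} {w′} e w-pres gf n with gf n
... | m , fn≡m , count = m , fn≡m , ↔-trans count (mk↔ₛ′ to′ from′ to∘from from∘to)
  where
  open Inverse e
  to′ : Σ _ (λ x → w x ≡ n) → Σ _ (λ y → w′ y ≡ n)
  to′ (x , wx≡n) = to x , trans (w-pres x) wx≡n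
  from′ : Σ _ (λ y → w′ y ≡ n) → Σ _ (λ x → w x ≡ n)
  from′ (y , wy≡n) = from y , trans (sym (w-pres (from y))) (trans (cong w′ (strictlyInverseˡ y)) wy≡n)
  to∘from : ∀ y → to′ (from′ y) ≡ y
  to∘from (y , _) = Σ-≡-irr (λ _ → ℕP.≡-irrelevant) (strictlyInverseˡ y)
  from∘to : ∀ x → from′ (to′ x) ≡ x
  from∘to (x , _) = Σ-≡-irr (λ _ → ℕP.≡-irrelevant) (strictlyInverseʳ x)

IsGF-qpow : ∀ e → IsGF (qpow e) ⊤ (λ _ → e)
IsGF-qpow e n with n ≡ᵇ e in eq
... | true = 1 , refl , Fin1↔ (λ { (tt , p) (tt , q) → cong (tt ,_) (ℕP.≡-irrelevant p q) })
                              (tt , sym (ℕP.≡ᵇ⇒≡ n e (Equivalence.from T-≡ eq)))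
... | false = 0 , refl , Fin0↔ λ { (tt , e≡n) → subst T eq (ℕP.≡⇒≡ᵇ n e (sym e≡n)) }

IsGF-one : IsGF oneₚ ⊤ (λ _ → 0)
IsGF-one = IsGF-qpow 0

IsGF-+ : ∀ {f g X Y w v} → IsGF f X w → IsGF g Y v → IsGF (f +ₚ g) (X ⊎ Y) [ w , v ]
IsGF-+ {X = X} {Y} {w} {v} gf gg n with gf n | gg n
... | m₁ , e₁ , c₁ | m₂ , e₂ , c₂ =
  m₁ ℕ.+ m₂ , trans (cong₂ _+_ e₁ e₂) (sym (ℤP.pos-+ m₁ m₂)) ,
  ↔-trans FinP.+↔⊎ (↔-trans (c₁ ⊎-↔ c₂) ⊎-Σ)
  where
  ⊎-Σ : (Σ X (λ x → w x ≡ n) ⊎ Σ Y (λ y → v y ≡ n)) ↔ Σ (X ⊎ Y) (λ z → [ w , v ] z ≡ n)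
  ⊎-Σ = mk↔ₛ′ (λ { (inj₁ (x , p)) → inj₁ x , p ; (inj₂ (y , p)) → inj₂ y , p })
               (λ { (inj₁ x , p) → inj₁ (x , p) ; (inj₂ y , p) → inj₂ (y , p) })
               (λ { (inj₁ x , p) → refl ; (inj₂ y , p) → refl })
               (λ { (inj₁ (x , p)) → refl ; (inj₂ (y , p)) → refl })

Σ<-counts : ∀ N (F : ℕ → ℤ) (Z : ℕ → Set) →
  (∀ i → i < N → Σ ℕ λ m → (F i ≡ + m) × (Fin m ↔ Z i)) →
  Σ ℕ λ m → (Σ< N F ≡ + m) × (Fin m ↔ Σ ℕ (λ i → (i < N) × Z i))
Σ<-counts zero F Z c = 0 , refl , Fin0↔ λ { (i , () , _) }
Σ<-counts (suc N) F Z c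
  with c 0 (s≤s z≤n) | Σ<-counts N (F ∘ suc) (Z ∘ suc) (λ i i<N → c (suc i) (s≤s i<N))
... | m₀ , e₀ , c₀ | m₁ , e₁ , c₁ =
  m₀ ℕ.+ m₁ , trans (cong₂ _+_ e₀ e₁) (sym (ℤP.pos-+ m₀ m₁)) ,
  ↔-trans FinP.+↔⊎ (↔-trans (c₀ ⊎-↔ c₁) split)
  where
  split : (Z 0 ⊎ Σ ℕ (λ i → (i < N) × Z (suc i))) ↔ Σ ℕ (λ i → (i < suc N) × Z i)
  split = mk↔ₛ′ (λ { (inj₁ z) → 0 , s≤s z≤n , z ; (inj₂ (i , i<N , z)) → suc i , s≤s i<N , z })
                (λ { (zero , _ , z) → inj₁ z ; (suc i , s≤s i<N , z) → inj₂ (i , i<N , z) })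
                (λ { (zero , s≤s z≤n , z) → refl ; (suc i , s≤s i<N , z) → refl })
                (λ { (inj₁ z) → refl ; (inj₂ (i , i<N , z)) → refl })

IsGF-* : ∀ {f g X Y w v} → IsGF f X w → IsGF g Y v →
  IsGF (f *ₚ g) (X × Y) (λ (x , y) → w x ℕ.+ v y)
IsGF-* {f} {g} {X} {Y} {w} {v} gf gg n with Σ<-counts (suc n) (λ i → f i * g (n ∸ i)) Z term
  where
  Z : ℕ → Set
  Z i = Σ X (λ x → w x ≡ i) × Σ Y (λ y → v y ≡ n ∸ i)
  term : ∀ i → i < suc n → Σ ℕ λ m → (f i * g (n ∸ i) ≡ + m) × (Fin m ↔ Z i)
  term i _ with gf i | gg (n ∸ i)
  ... | m₁ , e₁ , c₁ | m₂ , e₂ , c₂ =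
    m₁ ℕ.* m₂ , trans (cong₂ _*_ e₁ e₂) (sym (ℤP.pos-* m₁ m₂)) ,
    ↔-trans FinP.*↔× (c₁ ×-↔ c₂)
... | m , e , c = m , trans (sumℤ-map-upTo (suc n) (λ i → f i * g (n ∸ i))) e , ↔-trans c split
  where
  Split = Σ ℕ (λ i → (i < suc n) × (Σ X (λ x → w x ≡ i) × Σ Y (λ y → v y ≡ n ∸ i)))
  Joint = Σ (X × Y) (λ (x , y) → w x ℕ.+ v y ≡ n)
  join : Split → Joint
  join (i , s≤s i≤n , (x , refl) , (y , vy≡)) =
    (x , y) , trans (cong (w x ℕ.+_) vy≡) (ℕP.m+[n∸m]≡n i≤n)
  unjoin : Joint → Split
  unjoin ((x , y) , wv≡n) =
    w x , s≤s (subst (w x ≤_) wv≡n (ℕP.m≤m+n (w x) (v y))) , (x , refl) ,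
    (y , trans (sym (ℕP.m+n∸m≡n (w x) (v y))) (cong (_∸ w x) wv≡n))
  split : Split ↔ Joint
  split = mk↔ₛ′ join unjoin
    (λ { ((x , y) , _) → cong ((x , y) ,_) (ℕP.≡-irrelevant _ _) })
    (λ { (i , s≤s _ , (x , refl) , (y , _)) →
         cong₂ (λ p q → w x , p , (x , refl) , (y , q))
               (ℕP.≤-irrelevant _ _) (ℕP.≡-irrelevant _ _) })

Tuple : (ℕ → Set) → ℕ → Set
Tuple Y zero = ⊤
Tuple Y (suc M) = Y (suc M) × Tuple Y M

tupleWeight : (Y : ℕ → Set) → ((t : ℕ) → Y t → ℕ) → ∀ M → Tuple Y M → ℕ
tupleWeight Y w zero _ = 0
tupleWeight Y w (suc M) (y , u) = w (suc M) y ℕ.+ tupleWeight Y w M u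

IsGF-prodₚ : (Y : ℕ → Set) (w : (t : ℕ) → Y t → ℕ) (Φ : ℕ → PS) → ∀ M →
  (∀ t → 1 ≤ t → t ≤ M → IsGF (Φ t) (Y t) (w t)) →
  IsGF (prodₚ (map Φ (sizes M))) (Tuple Y M) (tupleWeight Y w M)
IsGF-prodₚ Y w Φ zero gf = IsGF-one
IsGF-prodₚ Y w Φ (suc M) gf =
  IsGF-* (gf (suc M) (s≤s z≤n) ℕP.≤-refl)
         (IsGF-prodₚ Y w Φ M λ t 1≤t t≤M → gf t 1≤t (ℕP.m≤n⇒m≤1+n t≤M))

IsGF-sumₚ : (Z : ℕ → Set) (w : (k : ℕ) → Z k → ℕ) (G : ℕ → PS) → ∀ N (g : ℕ → ℕ) →
  (∀ i → i < N → IsGF (G (g i)) (Z (g i)) (w (g i))) →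
  IsGF (sumₚ (map G (applyUpTo g N))) (Σ ℕ (λ i → (i < N) × Z (g i))) (λ (i , _ , z) → w (g i) z)
IsGF-sumₚ Z w G zero g gf n = 0 , refl , Fin0↔ λ { ((i , () , _) , _) }
IsGF-sumₚ Z w G (suc N) g gf =
  IsGF-↔ split (λ { (inj₁ z) → refl ; (inj₂ (i , i<N , z)) → refl })
    (IsGF-+ (gf 0 (s≤s z≤n)) (IsGF-sumₚ Z w G N (g ∘ suc) (λ i i<N → gf (suc i) (s≤s i<N))))
  where
  split : (Z (g 0) ⊎ Σ ℕ (λ i → (i < N) × Z (g (suc i)))) ↔ Σ ℕ (λ i → (i < suc N) × Z (g i))
  split = mk↔ₛ′ (λ { (inj₁ z) → 0 , s≤s z≤n , z ; (inj₂ (i , i<N , z)) → suc i , s≤s i<N , z })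
                (λ { (zero , _ , z) → inj₁ z ; (suc i , s≤s i<N , z) → inj₂ (i , i<N , z) })
                (λ { (zero , s≤s z≤n , z) → refl ; (suc i , s≤s i<N , z) → refl })
                (λ { (inj₁ z) → refl ; (inj₂ (i , i<N , z)) → refl })

least-satisfying : ∀ (f : ℕ → Bool) q → T (f q) →
  Σ ℕ (λ j → (j ≤ q) × T (f j) × (∀ i → i < j → ¬ T (f i)))
least-satisfying f zero fq = 0 , z≤n , fq , λ _ ()
least-satisfying f (suc q) fq with f 0 in eq
... | true = 0 , z≤n , Equivalence.from T-≡ eq , λ _ ()
... | false with least-satisfying (f ∘ suc) q fq
...   | j , j≤q , fj , minimal =
  suc j , s≤s j≤q , fj , λ { zero _ f0 → subst T eq f0 ; (suc i) (s≤s i<j) → minimal i i<j }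

Σ-↔ : ∀ {X Y : Set} (P : X → Set) (Q : Y → Set) (f : X → Y) (g : Y → X) →
  (∀ x → Irrelevant (P x)) → (∀ y → Irrelevant (Q y)) →
  (∀ x → P x → Q (f x)) → (∀ y → Q y → P (g y)) →
  (∀ x → P x → g (f x) ≡ x) → (∀ y → Q y → f (g y) ≡ y) → Σ X P ↔ Σ Y Q
Σ-↔ P Q f g P-irr Q-irr P⇒Q Q⇒P gf fg = mk↔ₛ′
  (λ (x , p) → f x , P⇒Q x p) (λ (y , q) → g y , Q⇒P y q)
  (λ (y , q) → Σ-≡-irr Q-irr (fg y q)) (λ (x , p) → Σ-≡-irr P-irr (gf x p))

T-∧⁺ : ∀ {x y} → T x → T y → T (x ∧ y)
T-∧⁺ p q = Equivalence.from T-∧ (p , q)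

T-∧ˡ : ∀ {x y} → T (x ∧ y) → T x
T-∧ˡ {x} {y} = proj₁ ∘ Equivalence.to (T-∧ {x} {y})

T-∧ʳ : ∀ {x y} → T (x ∧ y) → T y
T-∧ʳ {x} {y} = proj₂ ∘ Equivalence.to (T-∧ {x} {y})

≡ᵇ-refl : ∀ n → (n ≡ᵇ n) ≡ true
≡ᵇ-refl n = Equivalence.to T-≡ (ℕP.≡⇒≡ᵇ n n refl)

≡ᵇ-sym : ∀ m n → (m ≡ᵇ n) ≡ (n ≡ᵇ m)
≡ᵇ-sym zero zero = refl
≡ᵇ-sym zero (suc n) = refl
≡ᵇ-sym (suc m) zero = refl
≡ᵇ-sym (suc m) (suc n) = ≡ᵇ-sym m n

<⇒<ᵇ-true : ∀ {m n} → m < n → (m <ᵇ n) ≡ true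
<⇒<ᵇ-true = Equivalence.to T-≡ ∘ ℕP.<⇒<ᵇ

hasNonOverlined : ℕ → List Part → Bool
hasNonOverlined t = any (λ (s , ov) → not ov ∧ (s ≡ᵇ t))

copies : ℕ → ℕ → List Part
copies t c = replicate c (t , false)

block : ℕ → Bool → ℕ → List Part
block t true c = (t , true) ∷ copies t c
block t false c = copies t c

weight-++ : ∀ xs ys → weight (xs ++ ys) ≡ weight xs ℕ.+ weight ys
weight-++ [] ys = refl
weight-++ ((s , _) ∷ xs) ys = trans (cong (s ℕ.+_) (weight-++ xs ys)) (sym (ℕP.+-assoc s _ _))

weight-block : ∀ t b c → weight (block t b c) ≡ (if b then t else 0) ℕ.+ t ℕ.* c
weight-block t true c = cong (t ℕ.+_) (weight-copies c)
  where
  weight-copies : ∀ c → weight (copies t c) ≡ t ℕ.* c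
  weight-copies zero = sym (ℕP.*-zeroʳ t)
  weight-copies (suc c) = trans (cong (t ℕ.+_) (weight-copies c)) (sym (ℕP.*-suc t c))
weight-block t false zero = sym (ℕP.*-zeroʳ t)
weight-block t false (suc c) = trans (cong (t ℕ.+_) (weight-block t false c)) (sym (ℕP.*-suc t c))

length-block : ∀ t b c → length (block t b c) ≡ (if b then 1 else 0) ℕ.+ c
length-block t true c = cong suc (LP.length-replicate c)
length-block t false c = LP.length-replicate c

any-++ : ∀ (f : Part → Bool) xs ys → any f (xs ++ ys) ≡ any f xs ∨ any f ys
any-++ f [] ys = refl
any-++ f (p ∷ xs) ys rewrite any-++ f xs ys = sym (BP.∨-assoc (f p) _ _)

any-copies-false : ∀ (f : Part → Bool) t c → f (t , false) ≡ false → any f (copies t c) ≡ false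
any-copies-false f t zero e = refl
any-copies-false f t (suc c) e rewrite e = any-copies-false f t c e

any-copies-true : ∀ (f : Part → Bool) t c → f (t , false) ≡ true → any f (copies t c) ≡ (1 ≤ᵇ c)
any-copies-true f t zero e = refl
any-copies-true f t (suc c) e rewrite e = refl

module _ (s t : ℕ) where

  hasSize-block-≡ : ∀ b c → (s ≡ᵇ t) ≡ true → hasSize t (block s b c) ≡ b ∨ (1 ≤ᵇ c)
  hasSize-block-≡ true c e rewrite e = refl
  hasSize-block-≡ false c e = any-copies-true (λ p → proj₁ p ≡ᵇ t) s c e

  hasSize-block-≢ : ∀ b c → (s ≡ᵇ t) ≡ false → hasSize t (block s b c) ≡ false
  hasSize-block-≢ true c e rewrite e = any-copies-false (λ p → proj₁ p ≡ᵇ t) s c e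
  hasSize-block-≢ false c e = any-copies-false (λ p → proj₁ p ≡ᵇ t) s c e

  hasNonOverlined-block-≡ : ∀ b c → (s ≡ᵇ t) ≡ true →
    hasNonOverlined t (block s b c) ≡ (1 ≤ᵇ c)
  hasNonOverlined-block-≡ true c e = any-copies-true (λ (s , ov) → not ov ∧ (s ≡ᵇ t)) s c e
  hasNonOverlined-block-≡ false c e = any-copies-true (λ (s , ov) → not ov ∧ (s ≡ᵇ t)) s c e

  hasNonOverlined-block-≢ : ∀ b c → (s ≡ᵇ t) ≡ false → hasNonOverlined t (block s b c) ≡ false
  hasNonOverlined-block-≢ true c e = any-copies-false (λ (s , ov) → not ov ∧ (s ≡ᵇ t)) s c e
  hasNonOverlined-block-≢ false c e = any-copies-false (λ (s , ov) → not ov ∧ (s ≡ᵇ t)) s c e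

∈⇒≤weight : ∀ {p xs} → p ∈ xs → proj₁ p ≤ weight xs
∈⇒≤weight (here refl) = ℕP.m≤m+n _ _
∈⇒≤weight (there {x = (s , _)} p∈xs) = ℕP.≤-trans (∈⇒≤weight p∈xs) (ℕP.m≤n+m _ s)

hasSize⇒≤weight : ∀ t xs → T (hasSize t xs) → t ≤ weight xs
hasSize⇒≤weight t xs h with find (any⁻ (λ p → proj₁ p ≡ᵇ t) xs h)
... | (s , _) , s∈xs , s≡t = subst (_≤ weight xs) (ℕP.≡ᵇ⇒≡ s t s≡t) (∈⇒≤weight s∈xs)

hasNonOverlined⇒hasSize : ∀ t xs → T (hasNonOverlined t xs) → T (hasSize t xs)
hasNonOverlined⇒hasSize t xs h =
  any⁺ (λ p → proj₁ p ≡ᵇ t) (Any.map (λ {(s , ov)} → T-∧ʳ {not ov}) (any⁻ _ xs h))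

AllAtMost : ℕ → List Part → Set
AllAtMost M = All (λ p → proj₁ p ≤ M)

HeadBelow : ℕ → List Part → Set
HeadBelow t [] = ⊤
HeadBelow t ((s , _) ∷ _) = s < t

AllAtMost⇒HeadBelow : ∀ {M} π → AllAtMost M π → HeadBelow (suc M) π
AllAtMost⇒HeadBelow [] _ = tt
AllAtMost⇒HeadBelow (_ ∷ _) (s≤M ∷ _) = s≤s s≤M

AllAtMost-block : ∀ t b c → AllAtMost t (block t b c)
AllAtMost-block t true c = ℕP.≤-refl ∷ All.replicate⁺ c ℕP.≤-refl
AllAtMost-block t false c = All.replicate⁺ c ℕP.≤-refl

allPositive : List Part → Bool
allPositive = foldr (λ p r → (1 ≤ᵇ proj₁ p) ∧ r) true

fitsBefore : Part → List Part → Bool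
fitsBefore p [] = true
fitsBefore p (q ∷ _) = adjOK p q

sortedOK-∷ : ∀ p L → sortedOK (p ∷ L) ≡ fitsBefore p L ∧ sortedOK L
sortedOK-∷ p [] = refl
sortedOK-∷ p (q ∷ L) = refl

sortedOK-∷⁺ : ∀ p L → T (fitsBefore p L) → T (sortedOK L) → T (sortedOK (p ∷ L))
sortedOK-∷⁺ p L fits sorted = subst T (sym (sortedOK-∷ p L)) (T-∧⁺ fits sorted)

sortedOK-∷⁻ : ∀ p L → T (sortedOK (p ∷ L)) → T (fitsBefore p L) × T (sortedOK L)
sortedOK-∷⁻ p L sorted = Equivalence.to T-∧ (subst T (sortedOK-∷ p L) sorted)

fitsBefore-HeadBelow : ∀ t b R → HeadBelow t R → T (fitsBefore (t , b) R)
fitsBefore-HeadBelow t b [] _ = tt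
fitsBefore-HeadBelow t b ((s , _) ∷ R) s<t rewrite <⇒<ᵇ-true s<t = tt

fitsBefore-copy : ∀ t b R → T (fitsBefore (t , b) ((t , false) ∷ R))
fitsBefore-copy t b R = Equivalence.from T-∨ (inj₂ (subst (λ z → T (z ∧ true)) (sym (≡ᵇ-refl t)) tt))

adjOK⇒≤ : ∀ t b s b′ → T (adjOK (t , b) (s , b′)) → s ≤ t
adjOK⇒≤ t b s b′ h with Equivalence.to (T-∨ {s <ᵇ t}) h
... | inj₁ s<ᵇt = ℕP.<⇒≤ (ℕP.<ᵇ⇒< s t s<ᵇt)
... | inj₂ s≡ᵇt = ℕP.≤-reflexive (ℕP.≡ᵇ⇒≡ s t (T-∧ˡ {s ≡ᵇ t} s≡ᵇt))

fitsBefore-copies : ∀ t b c R → HeadBelow t R → T (fitsBefore (t , b) (copies t c ++ R))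
fitsBefore-copies t b zero R below = fitsBefore-HeadBelow t b R below
fitsBefore-copies t b (suc c) R _ = fitsBefore-copy t b (copies t c ++ R)

sortedOK-copies : ∀ t c R → T (sortedOK R) → HeadBelow t R → T (sortedOK (copies t c ++ R))
sortedOK-copies t zero R sorted below = sorted
sortedOK-copies t (suc c) R sorted below =
  sortedOK-∷⁺ (t , false) (copies t c ++ R) (fitsBefore-copies t false c R below)
    (sortedOK-copies t c R sorted below)

sortedOK-block : ∀ t b c R → T (sortedOK R) → HeadBelow t R → T (sortedOK (block t b c ++ R))
sortedOK-block t true c R sorted below =
  sortedOK-∷⁺ (t , true) (copies t c ++ R) (fitsBefore-copies t true c R below)
    (sortedOK-copies t c R sorted below)
sortedOK-block t false c R = sortedOK-copies t c R

allPositive-++ : ∀ xs ys → T (allPositive xs) → T (allPositive ys) → T (allPositive (xs ++ ys))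
allPositive-++ [] ys _ pos = pos
allPositive-++ ((s , _) ∷ xs) ys pos pos′ =
  T-∧⁺ (T-∧ˡ {1 ≤ᵇ s} pos) (allPositive-++ xs ys (T-∧ʳ {1 ≤ᵇ s} pos) pos′)

allPositive-copies : ∀ t c → 1 ≤ t → T (allPositive (copies t c))
allPositive-copies t zero 1≤t = tt
allPositive-copies t (suc c) 1≤t = T-∧⁺ (ℕP.≤⇒≤ᵇ 1≤t) (allPositive-copies t c 1≤t)

allPositive-block : ∀ t b c → 1 ≤ t → T (allPositive (block t b c))
allPositive-block t true c 1≤t = T-∧⁺ (ℕP.≤⇒≤ᵇ 1≤t) (allPositive-copies t c 1≤t)
allPositive-block t false c = allPositive-copies t c

isOverpartition-block : ∀ t b c R → 1 ≤ t → T (isOverpartition R) → HeadBelow t R →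
  T (isOverpartition (block t b c ++ R))
isOverpartition-block t b c R 1≤t ov below =
  T-∧⁺ (allPositive-++ (block t b c) R (allPositive-block t b c 1≤t) (T-∧ˡ {allPositive R} ov))
       (sortedOK-block t b c R (T-∧ʳ {allPositive R} ov) below)

isOverpartition-suffix : ∀ xs ys → T (isOverpartition (xs ++ ys)) → T (isOverpartition ys)
isOverpartition-suffix [] ys ov = ov
isOverpartition-suffix (p ∷ xs) ys ov = isOverpartition-suffix xs ys
  (T-∧⁺ (T-∧ʳ {1 ≤ᵇ proj₁ p} (T-∧ˡ {allPositive (p ∷ xs ++ ys)} ov))
        (proj₂ (sortedOK-∷⁻ p (xs ++ ys) (T-∧ʳ {allPositive (p ∷ xs ++ ys)} ov))))

sortedOK⇒AllAtMost : ∀ s b L → T (sortedOK ((s , b) ∷ L)) → AllAtMost s L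
sortedOK⇒AllAtMost s b [] _ = []
sortedOK⇒AllAtMost s b ((s′ , b′) ∷ L) sorted with sortedOK-∷⁻ (s , b) ((s′ , b′) ∷ L) sorted
... | fits , sorted′ =
  s′≤s ∷ All.map (λ s″≤s′ → ℕP.≤-trans s″≤s′ s′≤s) (sortedOK⇒AllAtMost s′ b′ L sorted′)
  where s′≤s = adjOK⇒≤ s b s′ b′ fits

-- splitting off the parts of size t from an overpartition with parts ≤ t
peelOverlined : ℕ → List Part → Bool × List Part
peelOverlined t [] = false , []
peelOverlined t ((s , true) ∷ π) = if s ≡ᵇ t then (true , π) else (false , (s , true) ∷ π)
peelOverlined t ((s , false) ∷ π) = false , (s , false) ∷ π

peelCopies : ℕ → List Part → ℕ × List Part
peelCopies t [] = 0 , []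
peelCopies t ((s , true) ∷ π) = 0 , (s , true) ∷ π
peelCopies t ((s , false) ∷ π) =
  if s ≡ᵇ t then (suc (proj₁ (peelCopies t π)) , proj₂ (peelCopies t π)) else (0 , (s , false) ∷ π)

topOverlined : ℕ → List Part → Bool
topOverlined t π = proj₁ (peelOverlined t π)

topCopies : ℕ → List Part → ℕ
topCopies t π = proj₁ (peelCopies t (proj₂ (peelOverlined t π)))

belowTop : ℕ → List Part → List Part
belowTop t π = proj₂ (peelCopies t (proj₂ (peelOverlined t π)))

consOverlined : ℕ → Bool → List Part → List Part
consOverlined t true L = (t , true) ∷ L
consOverlined t false L = L

peelOverlined-recon : ∀ t π →
  consOverlined t (proj₁ (peelOverlined t π)) (proj₂ (peelOverlined t π)) ≡ π
peelOverlined-recon t [] = refl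
peelOverlined-recon t ((s , true) ∷ π) with s ≡ᵇ t in eq
... | true = cong (λ z → (z , true) ∷ π) (sym (ℕP.≡ᵇ⇒≡ s t (Equivalence.from T-≡ eq)))
... | false = refl
peelOverlined-recon t ((s , false) ∷ π) = refl

peelCopies-recon : ∀ t π → copies t (proj₁ (peelCopies t π)) ++ proj₂ (peelCopies t π) ≡ π
peelCopies-recon t [] = refl
peelCopies-recon t ((s , true) ∷ π) = refl
peelCopies-recon t ((s , false) ∷ π) with s ≡ᵇ t in eq
... | true =
  cong₂ _∷_ (cong (_, false) (sym (ℕP.≡ᵇ⇒≡ s t (Equivalence.from T-≡ eq)))) (peelCopies-recon t π)
... | false = refl

block-belowTop : ∀ t π → block t (topOverlined t π) (topCopies t π) ++ belowTop t π ≡ π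
block-belowTop t π = trans (block-++ (topOverlined t π))
  (trans (cong (consOverlined t (topOverlined t π)) (peelCopies-recon t (proj₂ (peelOverlined t π))))
         (peelOverlined-recon t π))
  where
  block-++ : ∀ b → block t b (topCopies t π) ++ belowTop t π
                 ≡ consOverlined t b (copies t (topCopies t π) ++ belowTop t π)
  block-++ true = refl
  block-++ false = refl

<⇒≡ᵇ-false : ∀ {s t} → s < t → (s ≡ᵇ t) ≡ false
<⇒≡ᵇ-false = ≢⇒≡ᵇ-false ∘ ℕP.<⇒≢

module _ (t : ℕ) where

  peelCopies-copies : ∀ c R → HeadBelow t R → peelCopies t (copies t c ++ R) ≡ (c , R)
  peelCopies-copies (suc c) R below rewrite ≡ᵇ-refl t | peelCopies-copies c R below = refl
  peelCopies-copies zero [] _ = refl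
  peelCopies-copies zero ((s , true) ∷ R) _ = refl
  peelCopies-copies zero ((s , false) ∷ R) s<t rewrite <⇒≡ᵇ-false s<t = refl

  peelOverlined-block : ∀ b c R → HeadBelow t R →
    peelOverlined t (block t b c ++ R) ≡ (b , copies t c ++ R)
  peelOverlined-block true c R _ rewrite ≡ᵇ-refl t = refl
  peelOverlined-block false (suc c) R _ = refl
  peelOverlined-block false zero [] _ = refl
  peelOverlined-block false zero ((s , true) ∷ R) s<t rewrite <⇒≡ᵇ-false s<t = refl
  peelOverlined-block false zero ((s , false) ∷ R) _ = refl

  peel-block : ∀ b c R → HeadBelow t R →
    (topOverlined t (block t b c ++ R) , topCopies t (block t b c ++ R) , belowTop t (block t b c ++ R))
    ≡ (b , c , R)
  peel-block b c R below rewrite peelOverlined-block b c R below | peelCopies-copies c R below = refl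

HeadNotOverlined : ℕ → List Part → Set
HeadNotOverlined t ((s , true) ∷ _) = s ≢ t
HeadNotOverlined t _ = ⊤

-- only the first part of a given size can be overlined
fitsBefore⇒HeadNotOverlined : ∀ s b L → T (fitsBefore (s , b) L) → HeadNotOverlined s L
fitsBefore⇒HeadNotOverlined s b [] _ = tt
fitsBefore⇒HeadNotOverlined s b ((s′ , false) ∷ L) _ = tt
fitsBefore⇒HeadNotOverlined s b ((s′ , true) ∷ L) fits s′≡s
  with Equivalence.to (T-∨ {s′ <ᵇ s}) fits
... | inj₁ s′<ᵇs = ℕP.<⇒≢ (ℕP.<ᵇ⇒< s′ s s′<ᵇs) s′≡s
... | inj₂ s′≡ᵇs∧⊥ = T-∧ʳ {s′ ≡ᵇ s} s′≡ᵇs∧⊥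

peelCopies-HeadBelow : ∀ t L → T (sortedOK L) → AllAtMost t L → HeadNotOverlined t L →
  HeadBelow t (proj₂ (peelCopies t L))
peelCopies-HeadBelow t [] _ _ _ = tt
peelCopies-HeadBelow t ((s , true) ∷ L) _ (s≤t ∷ _) s≢t = ℕP.≤∧≢⇒< s≤t s≢t
peelCopies-HeadBelow t ((s , false) ∷ L) sorted (s≤t ∷ L≤t) _ with s ≡ᵇ t in eq
... | false = ℕP.≤∧≢⇒< s≤t (λ s≡t → subst T eq (ℕP.≡⇒≡ᵇ s t s≡t))
... | true with sortedOK-∷⁻ (s , false) L sorted
...   | fits , sorted′ rewrite ℕP.≡ᵇ⇒≡ s t (Equivalence.from T-≡ eq) =
  peelCopies-HeadBelow t L sorted′ L≤t (fitsBefore⇒HeadNotOverlined t false L fits)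

peelOverlined-HeadNotOverlined : ∀ t L → T (sortedOK L) → HeadNotOverlined t (proj₂ (peelOverlined t L))
peelOverlined-HeadNotOverlined t [] _ = tt
peelOverlined-HeadNotOverlined t ((s , false) ∷ L) _ = tt
peelOverlined-HeadNotOverlined t ((s , true) ∷ L) sorted with s ≡ᵇ t in eq
... | false = λ s≡t → subst T eq (ℕP.≡⇒≡ᵇ s t s≡t)
... | true rewrite ℕP.≡ᵇ⇒≡ s t (Equivalence.from T-≡ eq) =
  fitsBefore⇒HeadNotOverlined t true L (proj₁ (sortedOK-∷⁻ (t , true) L sorted))

belowTop-HeadBelow : ∀ t π → T (isOverpartition π) → AllAtMost t π → HeadBelow t (belowTop t π)
belowTop-HeadBelow t π ov π≤t =
  go π (peelOverlined t π) (peelOverlined-recon t π) (T-∧ʳ {allPositive π} ov) π≤t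
     (peelOverlined-HeadNotOverlined t π (T-∧ʳ {allPositive π} ov))
  where
  go : ∀ π bL → consOverlined t (proj₁ bL) (proj₂ bL) ≡ π → T (sortedOK π) → AllAtMost t π →
       HeadNotOverlined t (proj₂ bL) → HeadBelow t (proj₂ (peelCopies t (proj₂ bL)))
  go _ (true , L) refl sorted (_ ∷ L≤t) =
    peelCopies-HeadBelow t L (proj₂ (sortedOK-∷⁻ (t , true) L sorted)) L≤t
  go _ (false , L) refl sorted L≤t = peelCopies-HeadBelow t L sorted L≤t

-- Overpartitions with parts ≤ M as tuples indexed by the part sizes

-- at a size t: whether t occurs overlined, and how many non-overlined copies of t occur
SizeData : Set
SizeData = Bool × ℕ

sizeWeight : ℕ → SizeData → ℕ
sizeWeight t (b , c) = (if b then t else 0) ℕ.+ t ℕ.* c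

sizeLength : SizeData → ℕ
sizeLength (b , c) = (if b then 1 else 0) ℕ.+ c

OvVec : ℕ → Set
OvVec = Tuple (λ _ → SizeData)

ovVecWeight : ∀ M → OvVec M → ℕ
ovVecWeight = tupleWeight (λ _ → SizeData) sizeWeight

lookupSize : ∀ M → OvVec M → ℕ → SizeData
lookupSize zero _ t = false , 0
lookupSize (suc M) (d , v) t = if t ≡ᵇ suc M then d else lookupSize M v t

ovVecLength : ∀ M → OvVec M → ℕ
ovVecLength zero _ = 0
ovVecLength (suc M) (d , v) = sizeLength d ℕ.+ ovVecLength M v

toParts : ∀ M → OvVec M → List Part
toParts zero _ = []
toParts (suc M) ((b , c) , v) = block (suc M) b c ++ toParts M v

fromParts : ∀ M → List Part → OvVec M
fromParts zero π = tt
fromParts (suc M) π = (topOverlined (suc M) π , topCopies (suc M) π) , fromParts M (belowTop (suc M) π)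

weight-toParts : ∀ M v → weight (toParts M v) ≡ ovVecWeight M v
weight-toParts zero v = refl
weight-toParts (suc M) ((b , c) , v) = trans (weight-++ (block (suc M) b c) (toParts M v))
  (cong₂ ℕ._+_ (weight-block (suc M) b c) (weight-toParts M v))

length-toParts : ∀ M v → length (toParts M v) ≡ ovVecLength M v
length-toParts zero v = refl
length-toParts (suc M) ((b , c) , v) = trans (LP.length-++ (block (suc M) b c))
  (cong₂ ℕ._+_ (length-block (suc M) b c) (length-toParts M v))

toParts-valid : ∀ M v → T (isOverpartition (toParts M v)) × AllAtMost M (toParts M v)
toParts-valid zero v = tt , []
toParts-valid (suc M) ((b , c) , v) with toParts-valid M v
... | ov , ≤M =
  isOverpartition-block (suc M) b c (toParts M v) (s≤s z≤n) ov (AllAtMost⇒HeadBelow (toParts M v) ≤M) ,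
  All.++⁺ (AllAtMost-block (suc M) b c) (All.map ℕP.m≤n⇒m≤1+n ≤M)

fromParts-toParts : ∀ M v → fromParts M (toParts M v) ≡ v
fromParts-toParts zero tt = refl
fromParts-toParts (suc M) ((b , c) , v) =
  cong₂ _,_ (cong₂ _,_ (cong proj₁ peeled) (cong (proj₁ ∘ proj₂) peeled))
            (trans (cong (fromParts M ∘ proj₂ ∘ proj₂) peeled) (fromParts-toParts M v))
  where
  peeled = peel-block (suc M) b c (toParts M v)
             (AllAtMost⇒HeadBelow (toParts M v) (proj₂ (toParts-valid M v)))

toParts-fromParts : ∀ M π → T (isOverpartition π) → AllAtMost M π → toParts M (fromParts M π) ≡ π
toParts-fromParts zero [] _ _ = refl
toParts-fromParts zero ((s , o) ∷ π) ov (s≤0 ∷ _) =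
  contradiction (ℕP.≤-trans (ℕP.≤ᵇ⇒≤ 1 s (T-∧ˡ {1 ≤ᵇ s} (T-∧ˡ {allPositive ((s , o) ∷ π)} ov))) s≤0)
                λ ()
toParts-fromParts (suc M) π ov π≤M =
  trans (cong (block (suc M) b c ++_) (toParts-fromParts M R ovR R≤M)) (block-belowTop (suc M) π)
  where
  b = topOverlined (suc M) π
  c = topCopies (suc M) π
  R = belowTop (suc M) π
  ovR : T (isOverpartition R)
  ovR = isOverpartition-suffix (block (suc M) b c) R
          (subst (T ∘ isOverpartition) (sym (block-belowTop (suc M) π)) ov)
  R≤M : AllAtMost M R
  R≤M = below⇒≤M R (T-∧ʳ {allPositive R} ovR) (belowTop-HeadBelow (suc M) π ov π≤M)
    where
    below⇒≤M : ∀ R → T (sortedOK R) → HeadBelow (suc M) R → AllAtMost M R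
    below⇒≤M [] _ _ = []
    below⇒≤M ((s , o) ∷ L) sorted (s≤s s≤M) =
      s≤M ∷ All.map (λ s′≤s → ℕP.≤-trans s′≤s s≤M) (sortedOK⇒AllAtMost s o L sorted)

lookupSize-beyond : ∀ M v t → M < t → lookupSize M v t ≡ (false , 0)
lookupSize-beyond zero v t _ = refl
lookupSize-beyond (suc M) (d , v) t M<t rewrite ≢⇒≡ᵇ-false (ℕP.>⇒≢ M<t) =
  lookupSize-beyond M v t (ℕP.<-trans (ℕP.n<1+n M) M<t)

occurs : SizeData → Bool
occurs d = proj₁ d ∨ (1 ≤ᵇ proj₂ d)

hasCopy : SizeData → Bool
hasCopy d = 1 ≤ᵇ proj₂ d

hasSize-toParts : ∀ M v t → hasSize t (toParts M v) ≡ occurs (lookupSize M v t)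
hasSize-toParts zero v t = refl
hasSize-toParts (suc M) ((b , c) , v) t with t ≡ᵇ suc M in eq
... | true rewrite ℕP.≡ᵇ⇒≡ t (suc M) (Equivalence.from T-≡ eq) = begin
  hasSize (suc M) (block (suc M) b c ++ toParts M v)
    ≡⟨ any-++ _ (block (suc M) b c) (toParts M v) ⟩
  hasSize (suc M) (block (suc M) b c) ∨ hasSize (suc M) (toParts M v)
    ≡⟨ cong₂ _∨_ (hasSize-block-≡ (suc M) (suc M) b c (≡ᵇ-refl (suc M)))
                 (trans (hasSize-toParts M v (suc M))
                        (cong occurs (lookupSize-beyond M v (suc M) ℕP.≤-refl))) ⟩
  (b ∨ (1 ≤ᵇ c)) ∨ false
    ≡⟨ BP.∨-identityʳ _ ⟩
  b ∨ (1 ≤ᵇ c) ∎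
  where open ≡-Reasoning
... | false = trans (any-++ _ (block (suc M) b c) (toParts M v))
  (cong₂ _∨_ (hasSize-block-≢ (suc M) t b c (trans (≡ᵇ-sym (suc M) t) eq)) (hasSize-toParts M v t))

hasNonOverlined-toParts : ∀ M v t → hasNonOverlined t (toParts M v) ≡ hasCopy (lookupSize M v t)
hasNonOverlined-toParts zero v t = refl
hasNonOverlined-toParts (suc M) ((b , c) , v) t with t ≡ᵇ suc M in eq
... | true rewrite ℕP.≡ᵇ⇒≡ t (suc M) (Equivalence.from T-≡ eq) = begin
  hasNonOverlined (suc M) (block (suc M) b c ++ toParts M v)
    ≡⟨ any-++ _ (block (suc M) b c) (toParts M v) ⟩
  hasNonOverlined (suc M) (block (suc M) b c) ∨ hasNonOverlined (suc M) (toParts M v)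
    ≡⟨ cong₂ _∨_ (hasNonOverlined-block-≡ (suc M) (suc M) b c (≡ᵇ-refl (suc M)))
                 (trans (hasNonOverlined-toParts M v (suc M))
                        (cong hasCopy (lookupSize-beyond M v (suc M) ℕP.≤-refl))) ⟩
  (1 ≤ᵇ c) ∨ false
    ≡⟨ BP.∨-identityʳ _ ⟩
  1 ≤ᵇ c ∎
  where open ≡-Reasoning
... | false = trans (any-++ _ (block (suc M) b c) (toParts M v))
  (cong₂ _∨_ (hasNonOverlined-block-≢ (suc M) t b c (trans (≡ᵇ-sym (suc M) t) eq))
             (hasNonOverlined-toParts M v t))

IsGF-invOneMinus : ∀ t → 1 ≤ t → IsGF (invOneMinus t) ℕ (t ℕ.*_)
IsGF-invOneMinus t 1≤t n with Σ<-counts (suc n) F (λ j → n ≡ t ℕ.* j) term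
  where
  F : ℕ → ℤ
  F j = if n ≡ᵇ t ℕ.* j then + 1 else + 0
  term : ∀ j → j < suc n → Σ ℕ λ m → (F j ≡ + m) × (Fin m ↔ (n ≡ t ℕ.* j))
  term j _ with n ≡ᵇ t ℕ.* j in eq
  ... | true = 1 , refl , Fin1↔ ℕP.≡-irrelevant (ℕP.≡ᵇ⇒≡ n (t ℕ.* j) (Equivalence.from T-≡ eq))
  ... | false = 0 , refl , Fin0↔ (λ n≡tj → subst T eq (ℕP.≡⇒≡ᵇ n (t ℕ.* j) n≡tj))
... | m , e , c = m , trans (invOneMinus≡geomSum t n) e , ↔-trans c bounded
  where
  instance _ = ℕ.>-nonZero 1≤t
  bounded : Σ ℕ (λ j → (j < suc n) × (n ≡ t ℕ.* j)) ↔ Σ ℕ (λ c → t ℕ.* c ≡ n)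
  bounded = mk↔ₛ′ (λ { (j , _ , n≡tj) → j , sym n≡tj })
                  (λ { (c , tc≡n) → c , s≤s (subst (c ≤_) tc≡n (ℕP.m≤n*m c t)) , sym tc≡n })
                  (λ { (c , _) → cong (c ,_) (ℕP.≡-irrelevant _ _) })
                  (λ { (j , _ , _) →
                       cong (j ,_) (cong₂ _,_ (ℕP.≤-irrelevant _ _) (ℕP.≡-irrelevant _ _)) })

IsGF-ovFactor : ∀ t → 1 ≤ t → IsGF (ovFactor t) SizeData (sizeWeight t)
IsGF-ovFactor t 1≤t = IsGF-↔ ⊤⊎⊤×ℕ↔ (λ { (inj₁ tt , c) → refl ; (inj₂ tt , c) → refl })
  (IsGF-* (IsGF-+ IsGF-one (IsGF-qpow t)) (IsGF-invOneMinus t 1≤t))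
  where
  ⊤⊎⊤×ℕ↔ : ((⊤ ⊎ ⊤) × ℕ) ↔ SizeData
  ⊤⊎⊤×ℕ↔ = mk↔ₛ′ (λ { (inj₁ tt , c) → false , c ; (inj₂ tt , c) → true , c })
                  (λ { (false , c) → inj₁ tt , c ; (true , c) → inj₂ tt , c })
                  (λ { (false , c) → refl ; (true , c) → refl })
                  (λ { (inj₁ tt , c) → refl ; (inj₂ tt , c) → refl })

-- The data at a size t that is either forced to occur exactly once, overlined (first flag),
-- so that nothing is left to record, or forced to occur non-overlined (second flag), in which
-- case one non-overlined copy is left out of the record.
Slot : Bool → Set
Slot true = ⊤
Slot false = SizeData

slotWeight : ℕ → (forcedOverlined forcedCopy : Bool) → Slot forcedOverlined → ℕ
slotWeight t true _ _ = t
slotWeight t false true d = t ℕ.+ sizeWeight t d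
slotWeight t false false d = sizeWeight t d

slotFactor : ℕ → (forcedOverlined forcedCopy : Bool) → PS
slotFactor t true _ = qpow t
slotFactor t false true = qpow t *ₚ ovFactor t
slotFactor t false false = ovFactor t

IsGF-slotFactor : ∀ t o c → 1 ≤ t → IsGF (slotFactor t o c) (Slot o) (slotWeight t o c)
IsGF-slotFactor t true c _ = IsGF-qpow t
IsGF-slotFactor t false true 1≤t =
  IsGF-↔ ⊤×↔ (λ _ → refl) (IsGF-* (IsGF-qpow t) (IsGF-ovFactor t 1≤t))
  where
  ⊤×↔ : (⊤ × SizeData) ↔ SizeData
  ⊤×↔ = mk↔ₛ′ proj₂ (tt ,_) (λ _ → refl) (λ _ → refl)
IsGF-slotFactor t false false 1≤t = IsGF-ovFactor t 1≤t

slotOK : (o c : Bool) → SizeData → Bool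
slotOK true _ (b , n) = b ∧ (n ≡ᵇ 0)
slotOK false true (_ , n) = 1 ≤ᵇ n
slotOK false false _ = true

embedSlot : (o c : Bool) → Slot o → SizeData
embedSlot true _ _ = true , 0
embedSlot false true (b , n) = b , suc n
embedSlot false false d = d

restrictSlot : (o c : Bool) → SizeData → Slot o
restrictSlot true _ _ = tt
restrictSlot false true (b , n) = b , n ∸ 1
restrictSlot false false d = d

sizeWeight-embedSlot : ∀ t o c y → sizeWeight t (embedSlot o c y) ≡ slotWeight t o c y
sizeWeight-embedSlot t true c y = trans (cong (t ℕ.+_) (ℕP.*-zeroʳ t)) (ℕP.+-identityʳ t)
sizeWeight-embedSlot t false true (b , n) = begin
  (if b then t else 0) ℕ.+ t ℕ.* suc n     ≡⟨ cong ((if b then t else 0) ℕ.+_) (ℕP.*-suc t n) ⟩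
  (if b then t else 0) ℕ.+ (t ℕ.+ t ℕ.* n) ≡⟨ x∙yz≈y∙xz (if b then t else 0) t (t ℕ.* n) ⟩
  t ℕ.+ ((if b then t else 0) ℕ.+ t ℕ.* n) ∎
  where open ≡-Reasoning
sizeWeight-embedSlot t false false y = refl

restrictSlot-embedSlot : ∀ o c y → restrictSlot o c (embedSlot o c y) ≡ y
restrictSlot-embedSlot true c y = refl
restrictSlot-embedSlot false true (b , n) = refl
restrictSlot-embedSlot false false y = refl

embedSlot-restrictSlot : ∀ o c d → T (slotOK o c d) → embedSlot o c (restrictSlot o c d) ≡ d
embedSlot-restrictSlot true c (true , zero) _ = refl
embedSlot-restrictSlot false true (b , suc n) _ = refl
embedSlot-restrictSlot false false d _ = refl

slotOK-embedSlot : ∀ o c y → T (slotOK o c (embedSlot o c y))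
slotOK-embedSlot true c y = tt
slotOK-embedSlot false true (b , n) = tt
slotOK-embedSlot false false y = tt

hasCopy⇒≢ : ∀ {d} → T (hasCopy d) → d ≢ (true , 0)
hasCopy⇒≢ h refl = h

-- The progression a, a + A, a + 2A, …

module Progression (A a : ℕ) (a≥1 : 1 ≤ a) (A≥1 : 1 ≤ A) where

  x : ℕ → ℕ
  x i = a ℕ.+ i ℕ.* A

  x≥1 : ∀ i → 1 ≤ x i
  x≥1 i = ℕP.≤-trans a≥1 (ℕP.m≤m+n a (i ℕ.* A))

  x-suc : ∀ i → x i ℕ.+ A ≡ x (suc i)
  x-suc i = trans (ℕP.+-assoc a (i ℕ.* A) A) (cong (a ℕ.+_) (ℕP.+-comm (i ℕ.* A) A))

  x-<⁺ : ∀ {i j} → i < j → x i < x j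
  x-<⁺ i<j = ℕP.+-monoʳ-< a (ℕP.*-monoˡ-< A i<j)
    where instance _ = ℕ.>-nonZero A≥1

  x-<⁻ : ∀ {i j} → x i < x j → i < j
  x-<⁻ {i} {j} xi<xj = ℕP.≰⇒> λ j≤i → ℕP.<⇒≱ xi<xj (ℕP.+-monoʳ-≤ a (ℕP.*-monoˡ-≤ A j≤i))

  i<x : ∀ i → i < x i
  i<x i = ℕP.+-mono-≤ a≥1 (ℕP.m≤m*n i A)
    where instance _ = ℕ.>-nonZero A≥1

  congB-x : ∀ i → congB A a (x i) ≡ true
  congB-x i
    rewrite Equivalence.to T-≡ (ℕP.≤⇒≤ᵇ (ℕP.m≤m+n a (i ℕ.* A))) | ℕP.m+n∸m≡n a (i ℕ.* A) =
    trans (isYes≗does (A ∣? (i ℕ.* A))) (dec-true (A ∣? (i ℕ.* A)) (divides i refl))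

  congB⇒x : ∀ t → T (congB A a t) → Σ ℕ (λ i → t ≡ x i)
  congB⇒x t h with toWitness (T-∧ʳ {a ≤ᵇ t} h)
  ... | divides i t∸a≡iA =
    i , trans (sym (ℕP.m+[n∸m]≡n (ℕP.≤ᵇ⇒≤ a t (T-∧ˡ {a ≤ᵇ t} h)))) (cong (a ℕ.+_) t∸a≡iA)

  isEarlier : ℕ → ℕ → Bool
  isEarlier j t = congB A a t ∧ (t <ᵇ x j)

  private
    ≮⇒<ᵇ-false : ∀ {m n} → ¬ m < n → (m <ᵇ n) ≡ false
    ≮⇒<ᵇ-false {m} {n} m≮n with m <ᵇ n in eq
    ... | false = refl
    ... | true = contradiction (ℕP.<ᵇ⇒< m n (Equivalence.from T-≡ eq)) m≮n

  isEarlier-zero : ∀ t → isEarlier 0 t ≡ false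
  isEarlier-zero t with congB A a t in eq
  ... | false = refl
  ... | true with congB⇒x t (Equivalence.from T-≡ eq)
  ...   | i , refl = ≮⇒<ᵇ-false (ℕP.≤⇒≯ (x-≥ i))
    where
    x-≥ : ∀ i → x 0 ≤ x i
    x-≥ i = ℕP.≤-trans (ℕP.≤-reflexive (ℕP.+-identityʳ a)) (ℕP.m≤m+n a (i ℕ.* A))

  isEarlier-suc : ∀ j t → t ≢ x j → isEarlier (suc j) t ≡ isEarlier j t
  isEarlier-suc j t t≢xj with congB A a t in eq
  ... | false = refl
  ... | true with congB⇒x t (Equivalence.from T-≡ eq)
  ...   | i , refl with ℕP.<-cmp i j
  ...     | tri< i<j _ _ =
    trans (<⇒<ᵇ-true (x-<⁺ (ℕP.m<n⇒m<1+n i<j))) (sym (<⇒<ᵇ-true (x-<⁺ i<j)))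
  ...     | tri≈ _ refl _ = contradiction refl t≢xj
  ...     | tri> _ _ j<i = trans (≮⇒<ᵇ-false (λ xi<xsj → ℕP.<⇒≱ (x-<⁻ xi<xsj) j<i))
                                 (sym (≮⇒<ᵇ-false (λ xi<xj → ℕP.<-asym j<i (x-<⁻ xi<xj))))

  isEarlier-suc-x : ∀ j → isEarlier (suc j) (x j) ≡ true
  isEarlier-suc-x j rewrite congB-x j = <⇒<ᵇ-true (x-<⁺ (ℕP.n<1+n j))

  isEarlier-x : ∀ j → isEarlier j (x j) ≡ false
  isEarlier-x j rewrite congB-x j = ≮⇒<ᵇ-false {x j} (ℕP.<-irrefl refl)

  isEarlier⇒x : ∀ j t → T (isEarlier j t) → Σ ℕ (λ i → (i < j) × (t ≡ x i))
  isEarlier⇒x j t h with congB⇒x t (T-∧ˡ {congB A a t} h)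
  ... | i , refl = i , x-<⁻ (ℕP.<ᵇ⇒< (x i) (x j) (T-∧ʳ {congB A a (x i)} h)) , refl

  xSum : ℕ → ℕ
  xSum zero = 0
  xSum (suc k) = xSum k ℕ.+ x k

  xSum-closed : ∀ k → xSum k ≡ A ℕ.* (k C 2) ℕ.+ k ℕ.* a
  xSum-closed zero = sym (trans (ℕP.+-identityʳ (A ℕ.* (zero C 2))) (ℕP.*-zeroʳ A))
  xSum-closed (suc k) = begin
    xSum k ℕ.+ (a ℕ.+ k ℕ.* A)                     ≡⟨ cong (ℕ._+ (a ℕ.+ k ℕ.* A)) (xSum-closed k) ⟩
    A ℕ.* (k C 2) ℕ.+ k ℕ.* a ℕ.+ (a ℕ.+ k ℕ.* A)  ≡⟨ regroup A (k C 2) k a ⟩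
    A ℕ.* (k ℕ.+ k C 2) ℕ.+ suc k ℕ.* a
      ≡⟨ cong (λ u → A ℕ.* (u ℕ.+ k C 2) ℕ.+ suc k ℕ.* a) (sym (nC1≡n k)) ⟩
    A ℕ.* (k C 1 ℕ.+ k C 2) ℕ.+ suc k ℕ.* a
      ≡⟨ cong (λ u → A ℕ.* u ℕ.+ suc k ℕ.* a) (nCk+nC[k+1]≡[n+1]C[k+1] k 1) ⟩
    A ℕ.* (suc k C 2) ℕ.+ suc k ℕ.* a              ∎
    where
    open ≡-Reasoning
    regroup : ∀ m c k r → m ℕ.* c ℕ.+ k ℕ.* r ℕ.+ (r ℕ.+ k ℕ.* m) ≡ m ℕ.* (k ℕ.+ c) ℕ.+ suc k ℕ.* r
    regroup = solve-∀

  prodₚ-qpow-x : ∀ k → prodₚ (map (qpow ∘ x) (upTo k)) ≈ qpow (xSum k)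
  prodₚ-qpow-x zero = ≈-refl
  prodₚ-qpow-x (suc k) = ≈-trans (prodₚ-upTo-suc (qpow ∘ x) k)
    (≈-trans (*-congʳ (qpow (x k)) (prodₚ-qpow-x k)) (qpow-+ (xSum k) (x k)))

  earlierFactor : ℕ → PS
  earlierFactor i = qpow (x i) *ₚ ratio (x i)

  -- q^(A C(j+1,2) + (j+1) a) = q^(x 0) ⋯ q^(x j)
  summand-factor : ∀ j → summand A a (suc j) ≈ prodₚ (map earlierFactor (upTo j)) *ₚ qpow (x j)
  summand-factor j =
    ≈-trans (*-cong qpow-xSum (≈-sym (prodₚ-map-* (oneMinus ∘ x) (invOnePlus ∘ x) (upTo j))))
    (≈-trans (*-assoc Q (qpow (x j)) R)
    (≈-trans (*-congˡ Q (*-comm (qpow (x j)) R))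
    (≈-trans (≈-sym (*-assoc Q R (qpow (x j))))
    (*-congʳ (qpow (x j)) (≈-sym (prodₚ-map-* (qpow ∘ x) (ratio ∘ x) (upTo j)))))))
    where
    Q = prodₚ (map (qpow ∘ x) (upTo j))
    R = prodₚ (map (ratio ∘ x) (upTo j))
    qpow-xSum : qpow (A ℕ.* (suc j C 2) ℕ.+ suc j ℕ.* a) ≈ Q *ₚ qpow (x j)
    qpow-xSum = ≈-trans (≡⇒≈ (cong qpow (sym (xSum-closed (suc j)))))
                (≈-trans (≈-sym (prodₚ-qpow-x (suc j))) (prodₚ-upTo-suc (qpow ∘ x) j))

  -- the factor at size t of the overpartitions in which each x i (i < j) occurs once, overlined
  prefixFactor : ℕ → ℕ → PS
  prefixFactor j t = slotFactor t (isEarlier j t) false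

  -- … and in which, moreover, x j occurs non-overlined
  classFactor : ℕ → ℕ → PS
  classFactor j t = slotFactor t (isEarlier j t) (t ≡ᵇ x j)

  ovGF-*-earlier : ∀ M j → (∀ i → i < j → x i ≤ M) →
    ovGF M *ₚ prodₚ (map earlierFactor (upTo j)) ≈ prodₚ (map (prefixFactor j) (sizes M))
  ovGF-*-earlier M zero _ = ≈-trans (*-identityʳ (ovGF M)) (prodₚ-sizes-cong ovFactor (prefixFactor 0) M
    λ t _ _ → ≡⇒≈ (cong (λ b → slotFactor t b false) (sym (isEarlier-zero t))))
  ovGF-*-earlier M (suc j) x≤M =
    ≈-trans (*-congˡ (ovGF M) (prodₚ-upTo-suc earlierFactor j))
    (≈-trans (≈-sym (*-assoc (ovGF M) (prodₚ (map earlierFactor (upTo j))) (earlierFactor j)))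
    (≈-trans (*-congʳ (earlierFactor j) (ovGF-*-earlier M j (λ i i<j → x≤M i (ℕP.m<n⇒m<1+n i<j))))
    (prodₚ-sizes-* (prefixFactor j) (prefixFactor (suc j)) (earlierFactor j) (x j) M
      (x≥1 j) (x≤M j (ℕP.n<1+n j))
      (λ t _ _ t≢xj → ≡⇒≈ (cong (λ b → slotFactor t b false) (isEarlier-suc j t t≢xj)))
      at-xj)))
    where
    -- q^t = q^t · ovFactor t · ratio t
    at-xj : prefixFactor (suc j) (x j) ≈ prefixFactor j (x j) *ₚ earlierFactor j
    at-xj rewrite isEarlier-suc-x j | isEarlier-x j =
      ≈-trans (≈-sym (*-identityʳ (qpow (x j))))
      (≈-trans (*-congˡ (qpow (x j)) (≈-sym (ovFactor-*-ratio (x j) (x≥1 j))))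
      (*-left-comm (qpow (x j)) (ovFactor (x j)) (ratio (x j))))

  ovGF-*-summand : ∀ M j → (∀ i → i ≤ j → x i ≤ M) →
    ovGF M *ₚ summand A a (suc j) ≈ prodₚ (map (classFactor j) (sizes M))
  ovGF-*-summand M j x≤M =
    ≈-trans (*-congˡ (ovGF M) (summand-factor j))
    (≈-trans (≈-sym (*-assoc (ovGF M) (prodₚ (map earlierFactor (upTo j))) (qpow (x j))))
    (≈-trans (*-congʳ (qpow (x j)) (ovGF-*-earlier M j (λ i i<j → x≤M i (ℕP.<⇒≤ i<j))))
    (prodₚ-sizes-* (prefixFactor j) (classFactor j) (qpow (x j)) (x j) M (x≥1 j) (x≤M j ℕP.≤-refl)
      elsewhere at-xj)))
    where
    elsewhere : ∀ t → 1 ≤ t → t ≤ M → t ≢ x j → classFactor j t ≈ prefixFactor j t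
    elsewhere t _ _ t≢xj with isEarlier j t
    ... | true = ≈-refl
    ... | false rewrite ≢⇒≡ᵇ-false t≢xj = ≈-refl
    at-xj : classFactor j (x j) ≈ prefixFactor j (x j) *ₚ qpow (x j)
    at-xj rewrite isEarlier-x j | ≡ᵇ-refl (x j) = *-comm (qpow (x j)) (ovFactor (x j))

  ClassData : ℕ → ℕ → Set
  ClassData j t = Slot (isEarlier j t)

  classWeight : (j t : ℕ) → ClassData j t → ℕ
  classWeight j t = slotWeight t (isEarlier j t) (t ≡ᵇ x j)

  IsGF-ovGF-*-summand : ∀ M j → (∀ i → i ≤ j → x i ≤ M) →
    IsGF (ovGF M *ₚ summand A a (suc j)) (Tuple (ClassData j) M)
         (tupleWeight (ClassData j) (classWeight j) M)
  IsGF-ovGF-*-summand M j x≤M = IsGF-≈ (ovGF-*-summand M j x≤M)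
    (IsGF-prodₚ (ClassData j) (classWeight j) (classFactor j) M
      (λ t 1≤t _ → IsGF-slotFactor t (isEarlier j t) (t ≡ᵇ x j) 1≤t))

  -- large enough for the parts of an overpartition of n and for x 0, …, x (n - 1)
  bound : ℕ → ℕ
  bound n = x n ℕ.+ n

  x≤bound : ∀ n i → i < n → x i ≤ bound n
  x≤bound n i i<n = ℕP.≤-trans (ℕP.<⇒≤ (x-<⁺ i<n)) (ℕP.m≤m+n (x n) n)

  Classified : ℕ → Set
  Classified n = Σ ℕ (λ j → (j < n) × Tuple (ClassData j) (bound n))

  classifiedWeight : ∀ n → Classified n → ℕ
  classifiedWeight n (j , _ , u) = tupleWeight (ClassData j) (classWeight j) (bound n) u

  ClassifiedOfWeight : ℕ → Set
  ClassifiedOfWeight n = Σ (Classified n) (λ o → classifiedWeight n o ≡ n)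

  rhsCoeff≡ : ∀ n →
    rhsCoeff A a n ≡ sumₚ (map (λ k → ovGF (bound n) *ₚ summand A a k) (applyUpTo suc n)) n
  rhsCoeff≡ n = begin
    rhsCoeff A a n                               ≡⟨ sym (at (*-assoc (negQPochInf n) (invQPochInf n) S) n) ⟩
    ((negQPochInf n *ₚ invQPochInf n) *ₚ S) n    ≡⟨ at (*-congʳ S ∏onePlus∏invOneMinus) n ⟩
    (ovGF n *ₚ S) n                              ≡⟨ sym (ovGF-stable S n (x n) n ℕP.≤-refl) ⟩
    (ovGF M *ₚ S) n                              ≡⟨ at (*-sumₚ (ovGF M) (summand A a) (from1 n)) n ⟩
    sumₚ (map (λ k → ovGF M *ₚ summand A a k) (from1 n)) n
      ≡⟨ cong (λ L → sumₚ (map (λ k → ovGF M *ₚ summand A a k) L) n) (LP.map-upTo suc n) ⟩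
    sumₚ (map (λ k → ovGF M *ₚ summand A a k) (applyUpTo suc n)) n ∎
    where
    open ≡-Reasoning
    M = bound n
    S = sumₚ (map (summand A a) (from1 n))
    ∏onePlus∏invOneMinus : negQPochInf n *ₚ invQPochInf n ≈ ovGF n
    ∏onePlus∏invOneMinus =
      ≈-trans (≈-sym (prodₚ-map-* onePlus invOneMinus (from1 n))) (prodₚ-from1 ovFactor n)

  rhsCoeff-counts : ∀ n → Σ ℕ λ m → (rhsCoeff A a n ≡ + m) × (Fin m ↔ ClassifiedOfWeight n)
  rhsCoeff-counts n =
    let m , e , count = IsGF-sumₚ Z w (λ k → ovGF M *ₚ summand A a k) n suc classes n
    in m , trans (rhsCoeff≡ n) e , count
    where
    M = bound n
    Z : ℕ → Set
    Z k = Tuple (ClassData (k ∸ 1)) M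
    w : (k : ℕ) → Z k → ℕ
    w k = tupleWeight (ClassData (k ∸ 1)) (classWeight (k ∸ 1)) M
    classes : ∀ j → j < n → IsGF (ovGF M *ₚ summand A a (suc j)) (Z (suc j)) (w (suc j))
    classes j j<n = IsGF-ovGF-*-summand M j (λ i i≤j → x≤bound n i (ℕP.≤-<-trans i≤j j<n))

  embedAt : ∀ j t → ClassData j t → SizeData
  embedAt j t = embedSlot (isEarlier j t) (t ≡ᵇ x j)

  restrictAt : ∀ j t → SizeData → ClassData j t
  restrictAt j t = restrictSlot (isEarlier j t) (t ≡ᵇ x j)

  slotOKAt : ℕ → ℕ → SizeData → Bool
  slotOKAt j t = slotOK (isEarlier j t) (t ≡ᵇ x j)

  embed : ∀ j M → Tuple (ClassData j) M → OvVec M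
  embed j zero _ = tt
  embed j (suc M) (y , u) = embedAt j (suc M) y , embed j M u

  restrict : ∀ j M → OvVec M → Tuple (ClassData j) M
  restrict j zero _ = tt
  restrict j (suc M) (d , v) = restrictAt j (suc M) d , restrict j M v

  -- v lies in the image of embed j M
  inClass : ∀ j M → OvVec M → Bool
  inClass j zero _ = true
  inClass j (suc M) (d , v) = slotOKAt j (suc M) d ∧ inClass j M v

  weight-embed : ∀ j M u → ovVecWeight M (embed j M u) ≡ tupleWeight (ClassData j) (classWeight j) M u
  weight-embed j zero u = refl
  weight-embed j (suc M) (y , u) =
    cong₂ ℕ._+_ (sizeWeight-embedSlot (suc M) (isEarlier j (suc M)) (suc M ≡ᵇ x j) y) (weight-embed j M u)

  restrict-embed : ∀ j M u → restrict j M (embed j M u) ≡ u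
  restrict-embed j zero u = refl
  restrict-embed j (suc M) (y , u) =
    cong₂ _,_ (restrictSlot-embedSlot (isEarlier j (suc M)) (suc M ≡ᵇ x j) y) (restrict-embed j M u)

  embed-restrict : ∀ j M v → T (inClass j M v) → embed j M (restrict j M v) ≡ v
  embed-restrict j zero v _ = refl
  embed-restrict j (suc M) (d , v) ok = cong₂ _,_
    (embedSlot-restrictSlot (isEarlier j (suc M)) (suc M ≡ᵇ x j) d
       (T-∧ˡ {slotOKAt j (suc M) d} ok))
    (embed-restrict j M v (T-∧ʳ {slotOKAt j (suc M) d} ok))

  inClass-embed : ∀ j M u → T (inClass j M (embed j M u))
  inClass-embed j zero u = tt
  inClass-embed j (suc M) (y , u) =
    T-∧⁺ (slotOK-embedSlot (isEarlier j (suc M)) (suc M ≡ᵇ x j) y) (inClass-embed j M u)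

  inClass⇒slotOK : ∀ j M v t → T (inClass j M v) → 1 ≤ t → t ≤ M →
    T (slotOKAt j t (lookupSize M v t))
  inClass⇒slotOK j zero v t ok 1≤t t≤0 = contradiction (ℕP.≤-trans 1≤t t≤0) λ ()
  inClass⇒slotOK j (suc M) (d , v) t ok 1≤t t≤M with t ≡ᵇ suc M in eq
  ... | true rewrite ℕP.≡ᵇ⇒≡ t (suc M) (Equivalence.from T-≡ eq) = T-∧ˡ {slotOKAt j (suc M) d} ok
  ... | false = inClass⇒slotOK j M v t (T-∧ʳ {slotOKAt j (suc M) d} ok) 1≤t
                  (ℕP.≤-pred (ℕP.≤∧≢⇒< t≤M (λ t≡sM → subst T eq (ℕP.≡⇒≡ᵇ t (suc M) t≡sM))))

  slotOK⇒inClass : ∀ j M v → (∀ t → 1 ≤ t → t ≤ M → T (slotOKAt j t (lookupSize M v t))) →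
    T (inClass j M v)
  slotOK⇒inClass j zero v _ = tt
  slotOK⇒inClass j (suc M) (d , v) ok = T-∧⁺ top (slotOK⇒inClass j M v λ t 1≤t t≤M →
    subst (T ∘ slotOKAt j t) (lookup-below t t≤M) (ok t 1≤t (ℕP.m≤n⇒m≤1+n t≤M)))
    where
    top : T (slotOKAt j (suc M) d)
    top = subst (T ∘ slotOKAt j (suc M))
                (cong (λ z → if z then d else lookupSize M v (suc M)) (≡ᵇ-refl M))
                (ok (suc M) (s≤s z≤n) ℕP.≤-refl)
    lookup-below : ∀ t → t ≤ M → lookupSize (suc M) (d , v) t ≡ lookupSize M v t
    lookup-below t t≤M rewrite <⇒≡ᵇ-false {t} {suc M} (s≤s t≤M) = refl

  inClass-hasCopy : ∀ j M v → T (inClass j M v) → x j ≤ M → T (hasCopy (lookupSize M v (x j)))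
  inClass-hasCopy j M v ok xj≤M with inClass⇒slotOK j M v (x j) ok (x≥1 j) xj≤M
  ... | h rewrite isEarlier-x j | ≡ᵇ-refl (x j) = h

  inClass-earlier : ∀ j M v i → T (inClass j M v) → i < j → x i ≤ M →
    lookupSize M v (x i) ≡ (true , 0)
  inClass-earlier j M v i ok i<j xi≤M with inClass⇒slotOK j M v (x i) ok (x≥1 i) xi≤M
  ... | h rewrite congB-x i | <⇒<ᵇ-true (x-<⁺ i<j) = once (lookupSize M v (x i)) h
    where
    once : ∀ d → T (proj₁ d ∧ (proj₂ d ≡ᵇ 0)) → d ≡ (true , 0)
    once (true , zero) _ = refl

  inClass-unique : ∀ M j j′ v → T (inClass j M v) → T (inClass j′ M v) →
    x j ≤ M → x j′ ≤ M → j ≡ j′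
  inClass-unique M j j′ v ok ok′ xj≤M xj′≤M with ℕP.<-cmp j j′
  ... | tri≈ _ j≡j′ _ = j≡j′
  ... | tri< j<j′ _ _ = contradiction (inClass-earlier j′ M v j ok′ j<j′ xj≤M)
                                      (hasCopy⇒≢ (inClass-hasCopy j M v ok xj≤M))
  ... | tri> _ _ j′<j = contradiction (inClass-earlier j M v j′ ok j′<j xj′≤M)
                                      (hasCopy⇒≢ (inClass-hasCopy j′ M v ok′ xj′≤M))

  indicator : Bool → ℕ
  indicator b = if b then 1 else 0

  #earlier : ℕ → ℕ → ℕ
  #earlier j zero = 0
  #earlier j (suc M) = indicator (isEarlier j (suc M)) ℕ.+ #earlier j M

  #earlier-zero : ∀ M → #earlier 0 M ≡ 0
  #earlier-zero zero = refl
  #earlier-zero (suc M) rewrite isEarlier-zero (suc M) = #earlier-zero M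

  #earlier-suc-below : ∀ j M → M < x j → #earlier (suc j) M ≡ #earlier j M
  #earlier-suc-below j zero _ = refl
  #earlier-suc-below j (suc M) M<xj rewrite isEarlier-suc j (suc M) (ℕP.<⇒≢ M<xj) =
    cong (indicator (isEarlier j (suc M)) ℕ.+_) (#earlier-suc-below j M (ℕP.<-trans (ℕP.n<1+n M) M<xj))

  #earlier-suc : ∀ j M → x j ≤ M → #earlier (suc j) M ≡ suc (#earlier j M)
  #earlier-suc j zero xj≤0 = contradiction (ℕP.≤-trans (x≥1 j) xj≤0) λ ()
  #earlier-suc j (suc M) xj≤M with ℕP.m≤n⇒m<n∨m≡n xj≤M
  ... | inj₂ xj≡sM rewrite sym xj≡sM | isEarlier-suc-x j | isEarlier-x j =
    cong suc (#earlier-suc-below j M (ℕP.≤-reflexive (sym xj≡sM)))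
  ... | inj₁ (s≤s xj≤M′) rewrite isEarlier-suc j (suc M) (ℕP.>⇒≢ (s≤s xj≤M′)) =
    trans (cong (indicator (isEarlier j (suc M)) ℕ.+_) (#earlier-suc j M xj≤M′)) (ℕP.+-suc _ _)

  #earlier-x : ∀ j M → x j ≤ M → #earlier (suc j) M ≡ suc j
  #earlier-x zero M x0≤M = trans (#earlier-suc 0 M x0≤M) (cong suc (#earlier-zero M))
  #earlier-x (suc j) M xj≤M = trans (#earlier-suc (suc j) M xj≤M)
    (cong suc (#earlier-x j M (ℕP.<⇒≤ (ℕP.<-≤-trans (x-<⁺ (ℕP.n<1+n j)) xj≤M))))

  slotOK⇒≤sizeLength : ∀ j t d → T (slotOKAt j t d) →
    indicator (isEarlier (suc j) t) ≤ sizeLength d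
  slotOK⇒≤sizeLength j t d ok with t ≡ᵇ x j in eq
  ... | true rewrite ℕP.≡ᵇ⇒≡ t (x j) (Equivalence.from T-≡ eq) | isEarlier-suc-x j | isEarlier-x j =
    ℕP.≤-trans (ℕP.≤ᵇ⇒≤ 1 (proj₂ d) ok) (ℕP.m≤n+m (proj₂ d) (indicator (proj₁ d)))
  ... | false rewrite isEarlier-suc j t (λ t≡xj → subst T eq (ℕP.≡⇒≡ᵇ t (x j) t≡xj)) with isEarlier j t
  ...   | false = z≤n
  ...   | true with d
  ...     | true , _ = s≤s z≤n

  inClass-length : ∀ j M v → T (inClass j M v) → #earlier (suc j) M ≤ ovVecLength M v
  inClass-length j zero v _ = z≤n
  inClass-length j (suc M) (d , v) ok = ℕP.+-mono-≤
    (slotOK⇒≤sizeLength j (suc M) d (T-∧ˡ {slotOKAt j (suc M) d} ok))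
    (inClass-length j M v (T-∧ʳ {slotOKAt j (suc M) d} ok))

  mesFrom-≥ : ∀ F v π → v ≤ mesFrom A F v π
  mesFrom-≥ zero v π = ℕP.≤-refl
  mesFrom-≥ (suc F) v π with hasSize v π
  ... | true = ℕP.≤-trans (ℕP.m≤m+n v A) (mesFrom-≥ F (v ℕ.+ A) π)
  ... | false = ℕP.≤-refl

  <mesFrom⇒hasSize : ∀ F s q π → s ≤ q → x q < mesFrom A F (x s) π →
    ∀ i → s ≤ i → i ≤ q → T (hasSize (x i) π)
  <mesFrom⇒hasSize zero s q π s≤q xq< i _ _ = contradiction s≤q (ℕP.<⇒≱ (x-<⁻ xq<))
  <mesFrom⇒hasSize (suc F) s q π s≤q xq< i s≤i i≤q with hasSize (x s) π in eq
  ... | false = contradiction s≤q (ℕP.<⇒≱ (x-<⁻ xq<))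
  ... | true with ℕP.m≤n⇒m<n∨m≡n s≤i
  ...   | inj₂ refl = Equivalence.from T-≡ eq
  ...   | inj₁ s<i = <mesFrom⇒hasSize F (suc s) q π (ℕP.≤-trans s<i i≤q)
                       (subst (λ v → x q < mesFrom A F v π) (x-suc s) xq<) i s<i i≤q

  hasSize⇒<mesFrom : ∀ F s q π → s ≤ q → q < s ℕ.+ F →
    (∀ i → s ≤ i → i ≤ q → T (hasSize (x i) π)) → x q < mesFrom A F (x s) π
  hasSize⇒<mesFrom zero s q π s≤q q<s+0 _ =
    contradiction s≤q (ℕP.<⇒≱ (subst (q <_) (ℕP.+-identityʳ s) q<s+0))
  hasSize⇒<mesFrom (suc F) s q π s≤q q<s+F present
    rewrite Equivalence.to T-≡ (present s ℕP.≤-refl s≤q) with ℕP.m≤n⇒m<n∨m≡n s≤q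
  ... | inj₂ refl = ℕP.<-≤-trans (x-<⁺ (ℕP.n<1+n s))
    (subst (λ v → x (suc s) ≤ mesFrom A F v π) (sym (x-suc s)) (mesFrom-≥ F (x (suc s)) π))
  ... | inj₁ s<q = subst (λ v → x q < mesFrom A F v π) (sym (x-suc s))
    (hasSize⇒<mesFrom F (suc s) q π s<q (subst (q <_) (ℕP.+-suc s F) q<s+F)
                      (λ i s<i i≤q → present i (ℕP.<⇒≤ s<i) i≤q))

  mes≡mesFrom : ∀ π → mes A a π ≡ mesFrom A (suc (length π)) (x 0) π
  mes≡mesFrom π = cong (λ v → mesFrom A (suc (length π)) v π) (sym (ℕP.+-identityʳ a))

  property⇒ : ∀ π → T (property A a π) →
    Σ ℕ (λ q → T (hasNonOverlined (x q) π) × x q < mes A a π)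
  property⇒ π h with find (any⁻ _ π h)
  ... | (s , ov) , s∈π , ok with congB⇒x s (T-∧ˡ {congB A a s} (T-∧ʳ {not ov} ok))
  ...   | q , refl =
    q , any⁺ _ (lose s∈π (T-∧⁺ (T-∧ˡ {not ov} ok) (ℕP.≡⇒≡ᵇ (x q) (x q) refl))) ,
    ℕP.<ᵇ⇒< (x q) (mes A a π) (T-∧ʳ {congB A a (x q)} (T-∧ʳ {not ov} ok))

  property⇐ : ∀ π q → T (hasNonOverlined (x q) π) → x q < mes A a π → T (property A a π)
  property⇐ π q h xq<mes with find (any⁻ _ π h)
  ... | (s , ov) , s∈π , ok rewrite ℕP.≡ᵇ⇒≡ s (x q) (T-∧ʳ {not ov} ok) =
    any⁺ _ (lose s∈π (T-∧⁺ (T-∧ˡ {not ov} ok)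
                           (T-∧⁺ (Equivalence.from T-≡ (congB-x q)) (ℕP.<⇒<ᵇ xq<mes))))

  InSomeClass : (n : ℕ) → OvVec (bound n) → Set
  InSomeClass n v = Σ ℕ (λ j → (j < n) × T (inClass j (bound n) v))

  inClass⇒property : ∀ n v j → j < n → T (inClass j (bound n) v) →
    T (property A a (toParts (bound n) v))
  inClass⇒property n v j j<n ok = property⇐ π j copy (subst (x j <_) (sym (mes≡mesFrom π)) xj<mes)
    where
    M = bound n
    π = toParts M v
    copy : T (hasNonOverlined (x j) π)
    copy = subst T (sym (hasNonOverlined-toParts M v (x j))) (inClass-hasCopy j M v ok (x≤bound n j j<n))
    present : ∀ i → 0 ≤ i → i ≤ j → T (hasSize (x i) π)
    present i _ i≤j with ℕP.m≤n⇒m<n∨m≡n i≤j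
    ... | inj₂ refl = hasNonOverlined⇒hasSize (x i) π copy
    ... | inj₁ i<j = subst T (sym (hasSize-toParts M v (x i)))
      (subst (T ∘ occurs) (sym (inClass-earlier j M v i ok i<j (x≤bound n i (ℕP.<-trans i<j j<n)))) tt)
    -- x 0, …, x j are distinct sizes of π, so the search for mes does not run out of steps
    enough : suc j ≤ length π
    enough = subst (suc j ≤_) (sym (length-toParts M v))
      (subst (_≤ ovVecLength M v) (#earlier-x j M (x≤bound n j j<n)) (inClass-length j M v ok))
    xj<mes : x j < mesFrom A (suc (length π)) (x 0) π
    xj<mes = hasSize⇒<mesFrom (suc (length π)) 0 j π z≤n (ℕP.m≤n⇒m≤1+n enough) present

  property⇒inClass : ∀ n v → ovVecWeight (bound n) v ≡ n → T (property A a (toParts (bound n) v)) →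
    InSomeClass n v
  property⇒inClass n v wt hp with property⇒ (toParts (bound n) v) hp
  ... | q , copy-q , xq<mes with least-satisfying (λ i → hasNonOverlined (x i) (toParts (bound n) v)) q copy-q
  ...   | j , j≤q , copy-j , minimal = j , j<n , slotOK⇒inClass j M v slot
    where
    M = bound n
    π = toParts M v
    present : ∀ i → 0 ≤ i → i ≤ q → T (hasSize (x i) π)
    present = <mesFrom⇒hasSize (suc (length π)) 0 q π z≤n (subst (x q <_) (mes≡mesFrom π) xq<mes)
    j<n : j < n
    j<n = ℕP.≤-<-trans j≤q (ℕP.<-≤-trans (i<x q) (subst (x q ≤_) (trans (weight-toParts M v) wt)
            (hasSize⇒≤weight (x q) π (hasNonOverlined⇒hasSize (x q) π copy-q))))
    -- for i < j, x i occurs but not non-overlined: exactly once, overlined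
    once : ∀ i → i < j → lookupSize M v (x i) ≡ (true , 0)
    once i i<j = only-overlined (lookupSize M v (x i))
      (subst T (hasSize-toParts M v (x i)) (present i z≤n (ℕP.<⇒≤ (ℕP.<-≤-trans i<j j≤q))))
      (λ h → minimal i i<j (subst T (sym (hasNonOverlined-toParts M v (x i))) h))
      where
      only-overlined : ∀ d → T (occurs d) → ¬ T (hasCopy d) → d ≡ (true , 0)
      only-overlined (true , zero) _ _ = refl
      only-overlined (true , suc c) _ no-copy = contradiction tt no-copy
      only-overlined (false , suc c) _ no-copy = contradiction tt no-copy
    slot : ∀ t → 1 ≤ t → t ≤ M → T (slotOKAt j t (lookupSize M v t))
    slot t _ _ with isEarlier j t in e₁
    ... | true with isEarlier⇒x j t (Equivalence.from T-≡ e₁)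
    ...   | i , i<j , refl rewrite once i i<j = tt
    slot t _ _ | false with t ≡ᵇ x j in e₂
    ...   | true rewrite ℕP.≡ᵇ⇒≡ t (x j) (Equivalence.from T-≡ e₂) =
      subst T (hasNonOverlined-toParts M v (x j)) copy-j
    ...   | false = tt

  InSomeClass-irrelevant : ∀ n v → Irrelevant (InSomeClass n v)
  InSomeClass-irrelevant n v (j , j<n , ok) (j′ , j′<n , ok′)
    with inClass-unique (bound n) j j′ v ok ok′ (x≤bound n j j<n) (x≤bound n j′ j′<n)
  ... | refl = cong₂ (λ p h → j , p , h) (ℕP.≤-irrelevant j<n j′<n) (T-irrelevant ok ok′)

  EncodedOfWeight : ℕ → Set
  EncodedOfWeight n = Σ (OvVec (bound n)) (λ v → (ovVecWeight (bound n) v ≡ n) × InSomeClass n v)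

  Overpartitions : ℕ → Set
  Overpartitions n = Σ (List Part) (λ π → T (isOverpartition π) × (weight π ≡ n) × T (property A a π))

  classified↔encoded : ∀ n → ClassifiedOfWeight n ↔ EncodedOfWeight n
  classified↔encoded n = mk↔ₛ′ to from to∘from from∘to
    where
    M = bound n
    to : ClassifiedOfWeight n → EncodedOfWeight n
    to ((j , j<n , u) , wt) = embed j M u , trans (weight-embed j M u) wt , (j , j<n , inClass-embed j M u)
    from : EncodedOfWeight n → ClassifiedOfWeight n
    from (v , wt , (j , j<n , ok)) = (j , j<n , restrict j M v) ,
      trans (sym (weight-embed j M (restrict j M v))) (trans (cong (ovVecWeight M) (embed-restrict j M v ok)) wt)
    to∘from : ∀ y → to (from y) ≡ y
    to∘from (v , _ , (j , _ , ok)) = Σ-≡-irr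
      (λ v (p , c) (p′ , c′) → cong₂ _,_ (ℕP.≡-irrelevant p p′) (InSomeClass-irrelevant n v c c′))
      (embed-restrict j M v ok)
    from∘to : ∀ y → from (to y) ≡ y
    from∘to ((j , j<n , u) , _) =
      Σ-≡-irr (λ _ → ℕP.≡-irrelevant) (cong (λ u → j , j<n , u) (restrict-embed j M u))

  encoded↔overpartitions : ∀ n → EncodedOfWeight n ↔ Overpartitions n
  encoded↔overpartitions n = Σ-↔ _ _ (toParts M) (fromParts M)
    (λ v (p , c) (p′ , c′) → cong₂ _,_ (ℕP.≡-irrelevant p p′) (InSomeClass-irrelevant n v c c′))
    (λ π (ov , wt , pr) (ov′ , wt′ , pr′) →
      cong₂ _,_ (T-irrelevant ov ov′) (cong₂ _,_ (ℕP.≡-irrelevant wt wt′) (T-irrelevant pr pr′)))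
    (λ v (wt , (j , j<n , ok)) →
      proj₁ (toParts-valid M v) , trans (weight-toParts M v) wt , inClass⇒property n v j j<n ok)
    (λ π (ov , wt , pr) → let wt′ = weight-fromParts π ov wt in
      wt′ , property⇒inClass n (fromParts M π) wt′ (subst (T ∘ property A a) (sym (recon π ov wt)) pr))
    (λ v _ → fromParts-toParts M v)
    (λ π (ov , wt , _) → recon π ov wt)
    where
    M = bound n
    ≤weight : ∀ π → AllAtMost (weight π) π
    ≤weight [] = []
    ≤weight ((s , _) ∷ π) =
      ℕP.m≤m+n s (weight π) ∷ All.map (λ le → ℕP.≤-trans le (ℕP.m≤n+m (weight π) s)) (≤weight π)
    recon : ∀ π → T (isOverpartition π) → weight π ≡ n → toParts M (fromParts M π) ≡ π
    recon π ov wt = toParts-fromParts M π ov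
      (All.map (λ le → ℕP.≤-trans le (subst (_≤ M) (sym wt) (ℕP.m≤n+m n (x n)))) (≤weight π))
    weight-fromParts : ∀ π → T (isOverpartition π) → weight π ≡ n → ovVecWeight M (fromParts M π) ≡ n
    weight-fromParts π ov wt =
      trans (sym (weight-toParts M (fromParts M π))) (trans (cong weight (recon π ov wt)) wt)


corollary2p2 : (A a : ℕ) → 1 ≤ a → a ≤ A → (n : ℕ) →
    Σ ℕ (λ m → (rhsCoeff A a n ≡ + m) ×
      (Fin m ↔ Σ (List Part) (λ π →
        T (isOverpartition π) × (weight π ≡ n) × T (property A a π))))
corollary2p2 A a a≥1 a≤A n =
  let open Progression A a a≥1 (ℕP.≤-trans a≥1 a≤A)
      m , rhs≡m , count = rhsCoeff-counts n
  in m , rhs≡m , ↔-trans count (↔-trans (classified↔encoded n) (encoded↔overpartitions n))
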